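{- Let $(P_n\mid n\in\mathbb{N})$ be an enumeration of all isomorphism types of finite posets (including the empty poset), where $P_n$ has $k_n$ points, such that $m\le n$ implies $k_m\le k_n$. Define infinite matrices indexed by positive integers: $A=(a_{mn})$, $a_{mn}=\sum_{U\in\mathcal{U}(P_n),\ P_n|_U\simeq P_m} d(U^\circ)$; $B=(b_{mn})$, $b_{mn}=|\{U\in\mathcal{U}(P_n)\mid P_n|_U\simeq P_m\}|$; $C=(c_{mn})$, defined recursively by $c_{mn}=\delta_{mn}-\sum_{j=m+1}^{n} b_{mj}c_{jn}$; $D=(d_{mn})$, $d_{mn}=d(P_n)^m$; $E=(e_{mn})$, $e_{mn}=e(m,P_n)$. Let $I=(\delta_{mn})$ and $\vec I=(\delta_{m,n-1})$. Then $A$, $B$, $C$ are upper triangular, and (1) $BC=I$, hence $C=B^{ -1}$; (2) $EB=D$, hence $DC=E$; (3) $EA=\vec I E$; that is, if $E_m$ denotes the $m$-th row of $E$, then $E_mA=E_{m+1}$.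
   Context: For a finite poset $P$ on $K$, $\mathcal{U}(P)$ is its set of upsets, $d(\cdot)$ the number of downsets, $P|_U$ the induced subposet, and for $U\subseteq K$, $U^\circ=K\setminus\{y\mid \exists x\in K\setminus U: x\le_P y\}$, with $d(U^\circ)$ the downset number of the subposet induced on $U^\circ$. For a finite poset $Q$ on $L$ and a finite set $M$ disjoint from $L$ with $|M|=m$, $e(m,Q)$ is the number of partial orders on $M\cup L$ inducing $Q$ on $L$ whose set of minimal elements is exactly $M$. $\delta$ is the Kronecker delta. Matrix products are the usual ones (all occurring sums are finite). -}

module Defs where

open import Data.Bool using (Bool; true; false; _∧_; _∨_; not; if_then_else_; T)
open import Data.Nat as ℕ using (ℕ; zero; suc; _≤_; _<_; _∸_; _^_; _<ᵇ_)
open import Data.Fin as F using (Fin; toℕ; _↑ˡ_; _↑ʳ_)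
open import Data.Vec as V using (Vec; []; _∷_; lookup)
open import Data.List as L using (List; [_]; concatMap; allFin)
open import Data.Bool.ListAction using (all; any)
open import Data.Nat.ListAction using (sum)
open import Data.Integer as ℤ using (ℤ; +_)
open import Data.Product using (∃; _×_)
open import Relation.Nullary.Decidable using (⌊_⌋)
open import Relation.Binary.PropositionalEquality using (_≡_)

record FinPoset : Set where
  field
    size    : ℕ
    leq     : Fin size → Fin size → Bool
    refl    : ∀ x → T (leq x x)
    antisym : ∀ x y → T (leq x y) → T (leq y x) → x ≡ y
    trans   : ∀ x y z → T (leq x y) → T (leq y z) → T (leq x z)

open FinPoset public

record _≅_ (P Q : FinPoset) : Set where
  field
    to        : Fin (size P) → Fin (size Q)
    from      : Fin (size Q) → Fin (size P)
    from∘to   : ∀ x → from (to x) ≡ x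
    to∘from   : ∀ y → to (from y) ≡ y
    preserves : ∀ x y → leq P x y ≡ leq Q (to x) (to y)

_⇒ᵇ_ : Bool → Bool → Bool
a ⇒ᵇ b = not a ∨ b

_⇔ᵇ_ : Bool → Bool → Bool
a ⇔ᵇ b = (a ⇒ᵇ b) ∧ (b ⇒ᵇ a)

_=ᶠ_ : ∀ {n} → Fin n → Fin n → Bool
x =ᶠ y = ⌊ x F.≟ y ⌋

∀ᶠ : ∀ n → (Fin n → Bool) → Bool
∀ᶠ n p = all p (allFin n)

∃ᶠ : ∀ n → (Fin n → Bool) → Bool
∃ᶠ n p = any p (allFin n)

allVecs : ∀ {A : Set} → List A → (n : ℕ) → List (Vec A n)
allVecs xs zero    = [ [] ]
allVecs xs (suc n) = concatMap (λ x → L.map (x ∷_) (allVecs xs n)) xs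

bools : List Bool
bools = true L.∷ false L.∷ L.[]

Subset : ℕ → Set
Subset k = Vec Bool k

allSubsets : ∀ k → List (Subset k)
allSubsets k = allVecs bools k

_∈ˢ_ : ∀ {k} → Fin k → Subset k → Bool
x ∈ˢ U = lookup U x

count : ∀ {A : Set} → (A → Bool) → List A → ℕ
count p xs = sum (L.map (λ x → if p x then 1 else 0) xs)

module _ (P : FinPoset) where
  private
    k = size P
    _≤P_ = leq P

  isUpset : Subset k → Bool
  isUpset U = ∀ᶠ k λ x → ∀ᶠ k λ y → ((x ∈ˢ U) ∧ (x ≤P y)) ⇒ᵇ (y ∈ˢ U)

  isDownset : Subset k → Bool
  isDownset S = ∀ᶠ k λ x → ∀ᶠ k λ y → ((x ∈ˢ S) ∧ (y ≤P x)) ⇒ᵇ (y ∈ˢ S)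

  downsetNumber : ℕ
  downsetNumber = count isDownset (allSubsets k)

  inCirc : Subset k → Fin k → Bool
  inCirc U y = not (∃ᶠ k λ x → not (x ∈ˢ U) ∧ (x ≤P y))

  -- d(U°): number of downsets of the subposet induced on U°,
  -- i.e. subsets S ⊆ U° closed downwards inside U°.
  dCirc : Subset k → ℕ
  dCirc U = count (λ S →
      (∀ᶠ k λ x → (x ∈ˢ S) ⇒ᵇ inCirc U x)
    ∧ (∀ᶠ k λ x → ∀ᶠ k λ y →
          ((x ∈ˢ S) ∧ inCirc U y ∧ (y ≤P x)) ⇒ᵇ (y ∈ˢ S)))
    (allSubsets k)

  -- P|_U ≃ Q : there is a bijection f : Q → U that preserves and
  -- reflects the order (f ranges over all maps Fin (size Q) → Fin k).
  inducedIso : Subset k → FinPoset → Bool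
  inducedIso U Q = any (λ f →
        (∀ᶠ q λ a → ∀ᶠ q λ b → (lookup f a =ᶠ lookup f b) ⇒ᵇ (a =ᶠ b))
      ∧ (∀ᶠ k λ x → (x ∈ˢ U) ⇔ᵇ (∃ᶠ q λ a → lookup f a =ᶠ x))
      ∧ (∀ᶠ q λ a → ∀ᶠ q λ b → leq Q a b ⇔ᵇ (lookup f a ≤P lookup f b)))
    (allVecs (allFin k) q)
    where q = size Q

-- e(m,Q): partial orders on M ∪ L (carrier Fin (m + size Q), M = the
-- first m points, L = the last size Q points) inducing Q on L and whose
-- set of minimal elements is exactly M.

eNum : ℕ → FinPoset → ℕ
eNum m Q = count ok (allVecs (allVecs bools N) N)
  where
    q = size Q
    N = m ℕ.+ q
    ok : Vec (Vec Bool N) N → Bool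
    ok Rv =
        (∀ᶠ N λ x → R x x)
      ∧ (∀ᶠ N λ x → ∀ᶠ N λ y → (R x y ∧ R y x) ⇒ᵇ (x =ᶠ y))
      ∧ (∀ᶠ N λ x → ∀ᶠ N λ y → ∀ᶠ N λ z → (R x y ∧ R y z) ⇒ᵇ R x z)
      ∧ (∀ᶠ q λ a → ∀ᶠ q λ b → R (m ↑ʳ a) (m ↑ʳ b) ⇔ᵇ leq Q a b)
      ∧ (∀ᶠ N λ z → (∀ᶠ N λ w → R w z ⇒ᵇ (w =ᶠ z)) ⇔ᵇ (toℕ z <ᵇ m))
      where
        R : Fin N → Fin N → Bool
        R x y = lookup (lookup Rv x) y

-- Infinite integer matrices indexed by positive integers (entries at
-- index 0 are ignored), and the (finitely supported) matrix product.

Matrix : Set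
Matrix = ℕ → ℕ → ℤ

δ : ℕ → ℕ → ℤ
δ m n = if ⌊ m ℕ.≟ n ⌋ then + 1 else + 0

Σ₁ : ℕ → (ℕ → ℤ) → ℤ
Σ₁ zero    f = + 0
Σ₁ (suc N) f = Σ₁ N f ℤ.+ f (suc N)

-- Σ_{j=a}^{b} f j
Σ[_,_] : ℕ → ℕ → (ℕ → ℤ) → ℤ
Σ[ a , b ] f = Σ₁ (suc b ∸ a) (λ i → f (i ℕ.+ a ∸ 1))

-- (X Y)_{mn} = Z_{mn} : the series Σ_{j≥1} X_{mj} Y_{jn} has only
-- finitely many nonzero terms (its partial sums are eventually constant)
-- and its sum is Z_{mn}.
ProductIs : Matrix → Matrix → Matrix → Set
ProductIs X Y Z = ∀ m n → 1 ≤ m → 1 ≤ n →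
  ∃ λ N → ∀ N' → N ≤ N' → Σ₁ N' (λ j → X m j ℤ.* Y j n) ≡ Z m n

UpperTriangular : Matrix → Set
UpperTriangular X = ∀ m n → 1 ≤ n → n < m → X m n ≡ + 0

record IsEnumeration (P : ℕ → FinPoset) : Set where
  field
    complete  : ∀ Q → ∃ λ n → 1 ≤ n × (P n ≅ Q)
    distinct  : ∀ m n → 1 ≤ m → 1 ≤ n → P m ≅ P n → m ≡ n
    sizeMono  : ∀ m n → 1 ≤ m → m ≤ n → size (P m) ≤ size (P n)

module Matrices (P : ℕ → FinPoset) where

  A : Matrix
  A m n = + sum (L.map (λ U →
      if isUpset (P n) U ∧ inducedIso (P n) U (P m) then dCirc (P n) U else 0)
    (allSubsets (size (P n))))

  B : Matrix
  B m n = + count (λ U → isUpset (P n) U ∧ inducedIso (P n) U (P m))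
                  (allSubsets (size (P n)))

  -- c_{mn} = δ_{mn} − Σ_{j=m+1}^{n} b_{mj} c_{jn}, by recursion on n − m
  -- (implemented with fuel n ∸ m + 1, which always suffices).
  cFuel : ℕ → ℕ → ℕ → ℤ
  cFuel zero    m n = + 0
  cFuel (suc f) m n = δ m n ℤ.- Σ[ suc m , n ] (λ j → B m j ℤ.* cFuel f j n)

  C : Matrix
  C m n = cFuel (suc (n ∸ m)) m n

  D : Matrix
  D m n = + (downsetNumber (P n) ^ m)

  E : Matrix
  E m n = + eNum m (P n)

  I : Matrix
  I = δ

  Ī : Matrix
  Ī m n = δ (suc m) n

module Submission where

-- For an upset U of P with P|_U ≅ Q, a partial order on M ∪ Q whose minimal elements are exactly M
-- amounts to the tuple (V_i)_{i∈M} of upsets of P, V_i being the copy in U of the points above i; the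
-- V_i cover U because every point lies above a minimal one. Hence e(m, P|_U) = T_m(U), the number of
-- m-tuples of upsets of P with union U. Grouping the upsets of P_n by isomorphism type then gives
-- (E B)_{mn} = Σ_U T_m(U) = (number of upsets)^m = d(P_n)^m, and, splitting off the first upset V of
-- an (m+1)-tuple covering P_n, (E A)_{mn} = Σ_U d(U°) T_m(U) = T_{m+1}(P_n) = e(m+1, P_n), because
-- the upsets V with V ∪ U = P_n are exactly the complements of the downsets of U°. B C = I is the
-- recursion defining C, and the remaining identities are algebra of unitriangular matrices.

open import Defs hiding (refl; trans)

open import Data.Bool using (Bool; true; false; _∧_; _∨_; not; if_then_else_; T)
open import Data.Bool.Properties as BoolP using (T?)
open import Data.Empty using (⊥; ⊥-elim)
open import Data.Fin as F using (Fin; toℕ; _↑ˡ_; _↑ʳ_)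
open import Data.Fin.Permutation using (permutation; ↔⇒≡)
open import Data.Fin.Properties as FinP using ()
open import Data.Fin.Subset using (∁; _∪_; ⊤) renaming (⊥ to ∅)
open import Data.Integer using (ℤ; +_)
open import Data.Integer.Properties as ℤP using ()
open import Data.Integer.Solver using (module +-*-Solver)
open import Data.List using (List; []; _∷_; _++_; map; concatMap; allFin)
open import Data.List.Membership.Propositional using (_∈_; lose)
open import Data.List.Membership.Propositional.Properties using (∈-allFin; ∈-map⁺; ∈-concatMap⁺)
open import Data.List.Relation.Unary.All as All using ()
open import Data.List.Relation.Unary.All.Properties using (all⁺; all⁻; ¬All⇒Any¬)
open import Data.List.Relation.Unary.Any as Any using (here; there)
open import Data.List.Relation.Unary.Any.Properties using (any⁺; any⁻)
open import Data.Nat as ℕ using (ℕ; zero; suc; _^_; _∸_; _≤_; _<_; z≤n; s≤s)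
open import Data.Nat.Induction as ℕInd using ()
open import Data.Nat.ListAction using (sum)
open import Data.Nat.Properties as ℕP using ()
open import Data.Product using (∃; _×_; _,_; proj₁; proj₂)
open import Data.Sum using (_⊎_; inj₁; inj₂)
open import Data.Unit using (tt)
open import Data.Vec using (Vec; []; _∷_; lookup; tabulate)
open import Data.Vec.Properties as VecP using ()
open import Data.Vec.Relation.Binary.Pointwise.Extensional using (ext; Pointwise-≡⇒≡)
open import Function using (_∘_; id; Equivalence)
open import Induction.WellFounded using (Acc; acc)
open import Relation.Binary.Construct.On as On using ()
open import Relation.Binary.Definitions using (DecidableEquality)
open import Relation.Binary.PropositionalEquality
open import Relation.Nullary using (yes; no; ¬_)
open import Relation.Nullary.Decidable using (⌊_⌋; toWitness; fromWitness)

T⇒≡true : ∀ {b} → T b → b ≡ true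
T⇒≡true {true} _ = refl

¬T⇒≡false : ∀ {b} → ¬ T b → b ≡ false
¬T⇒≡false {true} h = ⊥-elim (h tt)
¬T⇒≡false {false} _ = refl

T-∧-intro : ∀ {a b} → T a → T b → T (a ∧ b)
T-∧-intro {true} {true} _ _ = tt

T-∧₁ : ∀ {a b} → T (a ∧ b) → T a
T-∧₁ {true} _ = tt

T-∧₂ : ∀ {a b} → T (a ∧ b) → T b
T-∧₂ {true} t = t

T-not-intro : ∀ {a} → ¬ T a → T (not a)
T-not-intro {true} h = h tt
T-not-intro {false} _ = tt

T-not-elim : ∀ {a} → T (not a) → ¬ T a
T-not-elim {true} ()

T-⇒-intro : ∀ {a b} → (T a → T b) → T (a ⇒ᵇ b)
T-⇒-intro {true} {true} _ = tt
T-⇒-intro {true} {false} h = h tt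
T-⇒-intro {false} _ = tt

T-⇒-elim : ∀ {a b} → T (a ⇒ᵇ b) → T a → T b
T-⇒-elim {true} {true} _ _ = tt

¬T-⇒-elim : ∀ {a b} → ¬ T (a ⇒ᵇ b) → T a × ¬ T b
¬T-⇒-elim {true} {true} h = ⊥-elim (h tt)
¬T-⇒-elim {true} {false} _ = tt , λ ()
¬T-⇒-elim {false} h = ⊥-elim (h tt)

bool-ext : ∀ {a b} → (T a → T b) → (T b → T a) → a ≡ b
bool-ext {true} {true} _ _ = refl
bool-ext {true} {false} h _ = ⊥-elim (h tt)
bool-ext {false} {true} _ g = ⊥-elim (g tt)
bool-ext {false} {false} _ _ = refl

⇔ᵇ⇒≡ : ∀ {a b} → T (a ⇔ᵇ b) → a ≡ b
⇔ᵇ⇒≡ {true} {true} _ = refl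
⇔ᵇ⇒≡ {false} {false} _ = refl

≡⇒⇔ᵇ : ∀ {a b} → a ≡ b → T (a ⇔ᵇ b)
≡⇒⇔ᵇ {true} refl = tt
≡⇒⇔ᵇ {false} refl = tt

∀ᶠ-intro : ∀ n {p : Fin n → Bool} → (∀ x → T (p x)) → T (∀ᶠ n p)
∀ᶠ-intro n {p} h = all⁻ p (All.universal h (allFin n))

∀ᶠ-elim : ∀ n {p : Fin n → Bool} → T (∀ᶠ n p) → ∀ x → T (p x)
∀ᶠ-elim n {p} t x = All.lookup (all⁺ p (allFin n) t) (∈-allFin x)

∀ᶠ-counterexample : ∀ n {p : Fin n → Bool} → ¬ T (∀ᶠ n p) → ∃ λ x → ¬ T (p x)
∀ᶠ-counterexample n {p} h = Any.satisfied (¬All⇒Any¬ (T? ∘ p) (allFin n) (h ∘ all⁻ p))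

∃ᶠ-intro : ∀ n {p : Fin n → Bool} x → T (p x) → T (∃ᶠ n p)
∃ᶠ-intro n {p} x t = any⁺ p (lose (∈-allFin x) t)

∃ᶠ-elim : ∀ n {p : Fin n → Bool} → T (∃ᶠ n p) → ∃ λ x → T (p x)
∃ᶠ-elim n {p} t = Any.satisfied (any⁻ p (allFin n) t)

=ᶠ-intro : ∀ {n} {x y : Fin n} → x ≡ y → T (x =ᶠ y)
=ᶠ-intro = fromWitness

=ᶠ-elim : ∀ {n} {x y : Fin n} → T (x =ᶠ y) → x ≡ y
=ᶠ-elim = toWitness

vec-ext : ∀ {A : Set} {n} {u v : Vec A n} → (∀ i → lookup u i ≡ lookup v i) → u ≡ v
vec-ext h = Pointwise-≡⇒≡ (ext h)

module Combinatorics where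
  open import Data.Nat using (_+_; _*_)

  ∑ : {A : Set} → List A → (A → ℕ) → ℕ
  ∑ xs f = sum (map f xs)

  syntax ∑ xs (λ x → e) = ∑[ x ∈ xs ] e

  𝟙 : Bool → ℕ
  𝟙 b = if b then 1 else 0

  𝟙-∧ : ∀ a b → 𝟙 (a ∧ b) ≡ 𝟙 a * 𝟙 b
  𝟙-∧ true b = sym (ℕP.+-identityʳ (𝟙 b))
  𝟙-∧ false b = refl

  *-if : ∀ x b y → x * (if b then y else 0) ≡ (if b then x * y else 0)
  *-if x true y = refl
  *-if x false y = ℕP.*-zeroʳ x

  module _ {A : Set} where

    ∑-cong : (xs : List A) {f g : A → ℕ} → (∀ x → f x ≡ g x) → ∑ xs f ≡ ∑ xs g
    ∑-cong [] e = refl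
    ∑-cong (x ∷ xs) e = cong₂ _+_ (e x) (∑-cong xs e)

    ∑-zero : (xs : List A) → ∑[ x ∈ xs ] 0 ≡ 0
    ∑-zero [] = refl
    ∑-zero (x ∷ xs) = ∑-zero xs

    ∑-+ : (xs : List A) (f g : A → ℕ) → ∑[ x ∈ xs ] (f x + g x) ≡ ∑ xs f + ∑ xs g
    ∑-+ [] f g = refl
    ∑-+ (x ∷ xs) f g = trans (cong (λ s → f x + g x + s) (∑-+ xs f g)) (interchange (f x) (g x) (∑ xs f) (∑ xs g))
      where open import Algebra.Properties.CommutativeSemigroup ℕP.+-commutativeSemigroup using (interchange)

    ∑-*ˡ : (xs : List A) (c : ℕ) (f : A → ℕ) → ∑[ x ∈ xs ] (c * f x) ≡ c * ∑ xs f
    ∑-*ˡ [] c f = sym (ℕP.*-zeroʳ c)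
    ∑-*ˡ (x ∷ xs) c f = trans (cong (λ s → c * f x + s) (∑-*ˡ xs c f)) (sym (ℕP.*-distribˡ-+ c (f x) (∑ xs f)))

    ∑-*ʳ : (xs : List A) (c : ℕ) (f : A → ℕ) → ∑[ x ∈ xs ] (f x * c) ≡ ∑ xs f * c
    ∑-*ʳ [] c f = refl
    ∑-*ʳ (x ∷ xs) c f = trans (cong (λ s → f x * c + s) (∑-*ʳ xs c f)) (sym (ℕP.*-distribʳ-+ c (f x) (∑ xs f)))

    ∑-++ : (xs ys : List A) (f : A → ℕ) → ∑ (xs ++ ys) f ≡ ∑ xs f + ∑ ys f
    ∑-++ [] ys f = refl
    ∑-++ (x ∷ xs) ys f = trans (cong (λ s → f x + s) (∑-++ xs ys f)) (sym (ℕP.+-assoc (f x) (∑ xs f) (∑ ys f)))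

    ∑-mono-≤ : (xs : List A) {f g : A → ℕ} → (∀ x → f x ≤ g x) → ∑ xs f ≤ ∑ xs g
    ∑-mono-≤ [] h = z≤n
    ∑-mono-≤ (x ∷ xs) h = ℕP.+-mono-≤ (h x) (∑-mono-≤ xs h)

    ∑-mono-< : (xs : List A) {f g : A → ℕ} → (∀ x → f x ≤ g x) → ∀ {a} → a ∈ xs → f a < g a → ∑ xs f < ∑ xs g
    ∑-mono-< (x ∷ xs) h (here refl) lt = ℕP.+-mono-<-≤ lt (∑-mono-≤ xs h)
    ∑-mono-< (x ∷ xs) h (there a∈xs) lt = ℕP.+-mono-≤-< (h x) (∑-mono-< xs h a∈xs lt)

  module _ {A B : Set} where

    ∑-comm : (xs : List A) (ys : List B) (f : A → B → ℕ) →
      ∑[ x ∈ xs ] ∑[ y ∈ ys ] f x y ≡ ∑[ y ∈ ys ] ∑[ x ∈ xs ] f x y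
    ∑-comm [] ys f = sym (∑-zero ys)
    ∑-comm (x ∷ xs) ys f = trans (cong (λ s → ∑ ys (f x) + s) (∑-comm xs ys f)) (sym (∑-+ ys (f x) _))

    ∑-map : (xs : List A) (g : A → B) (f : B → ℕ) → ∑ (map g xs) f ≡ ∑[ x ∈ xs ] f (g x)
    ∑-map [] g f = refl
    ∑-map (x ∷ xs) g f = cong (λ s → f (g x) + s) (∑-map xs g f)

    ∑-concatMap : (xs : List A) (g : A → List B) (f : B → ℕ) → ∑ (concatMap g xs) f ≡ ∑[ x ∈ xs ] ∑ (g x) f
    ∑-concatMap [] g f = refl
    ∑-concatMap (x ∷ xs) g f = trans (∑-++ (g x) (concatMap g xs) f) (cong (λ s → ∑ (g x) f + s) (∑-concatMap xs g f))

  ∑-allVecs-suc : {A : Set} (xs : List A) (n : ℕ) (f : Vec A (suc n) → ℕ) →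
    ∑ (allVecs xs (suc n)) f ≡ ∑[ x ∈ xs ] ∑[ v ∈ allVecs xs n ] f (x ∷ v)
  ∑-allVecs-suc xs n f = trans (∑-concatMap xs _ f) (∑-cong xs λ x → ∑-map (allVecs xs n) (x ∷_) f)

  ∈-allVecs : {A : Set} {xs : List A} → (∀ x → x ∈ xs) → ∀ n (v : Vec A n) → v ∈ allVecs xs n
  ∈-allVecs complete zero [] = here refl
  ∈-allVecs {xs = xs} complete (suc n) (a ∷ v) =
    ∈-concatMap⁺ (λ x → map (x ∷_) (allVecs xs n)) (Any.map (λ { refl → ∈-map⁺ (a ∷_) (∈-allVecs complete n v) }) (complete a))

  module _ {A : Set} (_≟_ : DecidableEquality A) where

    Enumerates : List A → Set
    Enumerates xs = ∀ a → count (λ x → ⌊ a ≟ x ⌋) xs ≡ 1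

    ∑-select : ∀ xs → Enumerates xs → ∀ a (f : A → ℕ) → ∑[ x ∈ xs ] (𝟙 ⌊ a ≟ x ⌋ * f x) ≡ f a
    ∑-select xs enum a f = begin
      ∑[ x ∈ xs ] (𝟙 ⌊ a ≟ x ⌋ * f x)  ≡⟨ ∑-cong xs at-a ⟩
      ∑[ x ∈ xs ] (𝟙 ⌊ a ≟ x ⌋ * f a)  ≡⟨ ∑-*ʳ xs (f a) _ ⟩
      count (λ x → ⌊ a ≟ x ⌋) xs * f a ≡⟨ cong (_* f a) (enum a) ⟩
      1 * f a                          ≡⟨ ℕP.*-identityˡ (f a) ⟩
      f a                              ∎
      where
      open ≡-Reasoning
      at-a : ∀ x → 𝟙 ⌊ a ≟ x ⌋ * f x ≡ 𝟙 ⌊ a ≟ x ⌋ * f a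
      at-a x with a ≟ x
      ... | yes refl = refl
      ... | no _ = refl

  module _ {A B : Set} (_≟A_ : DecidableEquality A) (_≟B_ : DecidableEquality B)
           (xs : List A) (ys : List B) (enumA : Enumerates _≟A_ xs) (enumB : Enumerates _≟B_ ys)
           (p : A → Bool) (q : B → Bool) (φ : A → B) (ψ : B → A)
           (φ-pres : ∀ x → T (p x) → T (q (φ x))) (ψ-pres : ∀ y → T (q y) → T (p (ψ y)))
           (ψ∘φ : ∀ x → T (p x) → ψ (φ x) ≡ x) (φ∘ψ : ∀ y → T (q y) → φ (ψ y) ≡ y) where

    count-bijection : count p xs ≡ count q ys
    count-bijection = begin
      ∑[ x ∈ xs ] 𝟙 (p x)                                ≡⟨ ∑-cong xs (λ x → sym (∑-select _≟B_ ys enumB (φ x) _)) ⟩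
      ∑[ x ∈ xs ] ∑[ y ∈ ys ] (𝟙 ⌊ φ x ≟B y ⌋ * 𝟙 (p x)) ≡⟨ ∑-cong xs (λ x → ∑-cong ys (graph-sym x)) ⟩
      ∑[ x ∈ xs ] ∑[ y ∈ ys ] (𝟙 ⌊ ψ y ≟A x ⌋ * 𝟙 (q y)) ≡⟨ ∑-comm xs ys _ ⟩
      ∑[ y ∈ ys ] ∑[ x ∈ xs ] (𝟙 ⌊ ψ y ≟A x ⌋ * 𝟙 (q y)) ≡⟨ ∑-cong ys (λ y → ∑-select _≟A_ xs enumA (ψ y) _) ⟩
      ∑[ y ∈ ys ] 𝟙 (q y)                                ∎
      where
      open ≡-Reasoning
      graph-sym : ∀ x y → 𝟙 ⌊ φ x ≟B y ⌋ * 𝟙 (p x) ≡ 𝟙 ⌊ ψ y ≟A x ⌋ * 𝟙 (q y)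
      graph-sym x y = begin
        𝟙 ⌊ φ x ≟B y ⌋ * 𝟙 (p x) ≡⟨ sym (𝟙-∧ _ (p x)) ⟩
        𝟙 (⌊ φ x ≟B y ⌋ ∧ p x)   ≡⟨ cong 𝟙 (bool-ext to from) ⟩
        𝟙 (⌊ ψ y ≟A x ⌋ ∧ q y)   ≡⟨ 𝟙-∧ _ (q y) ⟩
        𝟙 ⌊ ψ y ≟A x ⌋ * 𝟙 (q y) ∎
        where
        to : T (⌊ φ x ≟B y ⌋ ∧ p x) → T (⌊ ψ y ≟A x ⌋ ∧ q y)
        to t with refl ← toWitness {a? = φ x ≟B y} (T-∧₁ t) =
          T-∧-intro (fromWitness (ψ∘φ x (T-∧₂ t))) (φ-pres x (T-∧₂ t))
        from : T (⌊ ψ y ≟A x ⌋ ∧ q y) → T (⌊ φ x ≟B y ⌋ ∧ p x)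
        from t with refl ← toWitness {a? = ψ y ≟A x} (T-∧₁ t) =
          T-∧-intro (fromWitness (φ∘ψ y (T-∧₂ t))) (ψ-pres y (T-∧₂ t))

  enumerates-bools : Enumerates BoolP._≟_ bools
  enumerates-bools true = refl
  enumerates-bools false = refl

  enumerates-allVecs : {A : Set} (_≟_ : DecidableEquality A) {xs : List A} → Enumerates _≟_ xs →
    ∀ n → Enumerates (VecP.≡-dec _≟_) (allVecs xs n)
  enumerates-allVecs _≟_ enum zero [] = refl
  enumerates-allVecs _≟_ {xs} enum (suc n) (a ∷ as) = begin
    count (λ v → ⌊ (a ∷ as) ≟ᵛ v ⌋) (allVecs xs (suc n))
      ≡⟨ ∑-allVecs-suc xs n _ ⟩
    ∑[ x ∈ xs ] ∑[ v ∈ allVecs xs n ] 𝟙 ⌊ (a ∷ as) ≟ᵛ (x ∷ v) ⌋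
      ≡⟨ ∑-cong xs (λ x → ∑-cong (allVecs xs n) (λ v → trans (cong 𝟙 (∷-≟-∷ x v)) (𝟙-∧ ⌊ a ≟ x ⌋ ⌊ as ≟ᵛ v ⌋))) ⟩
    ∑[ x ∈ xs ] ∑[ v ∈ allVecs xs n ] (𝟙 ⌊ a ≟ x ⌋ * 𝟙 ⌊ as ≟ᵛ v ⌋)
      ≡⟨ ∑-cong xs (λ x → ∑-*ˡ (allVecs xs n) (𝟙 ⌊ a ≟ x ⌋) (λ v → 𝟙 ⌊ as ≟ᵛ v ⌋)) ⟩
    ∑[ x ∈ xs ] (𝟙 ⌊ a ≟ x ⌋ * count (λ v → ⌊ as ≟ᵛ v ⌋) (allVecs xs n))
      ≡⟨ ∑-select _≟_ xs enum a _ ⟩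
    count (λ v → ⌊ as ≟ᵛ v ⌋) (allVecs xs n)
      ≡⟨ enumerates-allVecs _≟_ enum n as ⟩
    1 ∎
    where
    open ≡-Reasoning
    _≟ᵛ_ : ∀ {m} → DecidableEquality (Vec _ m)
    _≟ᵛ_ = VecP.≡-dec _≟_
    ∷-≟-∷ : ∀ x v → ⌊ (a ∷ as) ≟ᵛ (x ∷ v) ⌋ ≡ ⌊ a ≟ x ⌋ ∧ ⌊ as ≟ᵛ v ⌋
    ∷-≟-∷ x v = bool-ext
      (λ t → let e = toWitness {a? = (a ∷ as) ≟ᵛ (x ∷ v)} t in
             T-∧-intro {⌊ a ≟ x ⌋} {⌊ as ≟ᵛ v ⌋} (fromWitness (VecP.∷-injectiveˡ e)) (fromWitness (VecP.∷-injectiveʳ e)))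
      (λ t → fromWitness (cong₂ _∷_ (toWitness {a? = a ≟ x} (T-∧₁ t)) (toWitness {a? = as ≟ᵛ v} (T-∧₂ t))))

  infix 4 _≟ˢ_
  _≟ˢ_ : ∀ {k} → DecidableEquality (Subset k)
  _≟ˢ_ = VecP.≡-dec BoolP._≟_

  enumerates-allSubsets : ∀ k → Enumerates _≟ˢ_ (allSubsets k)
  enumerates-allSubsets = enumerates-allVecs BoolP._≟_ enumerates-bools

  𝟙-mono : ∀ {a b} → (T a → T b) → 𝟙 a ≤ 𝟙 b
  𝟙-mono {false} _ = z≤n
  𝟙-mono {true} {true} _ = s≤s z≤n
  𝟙-mono {true} {false} h = ⊥-elim (h tt)

  IsMinimal : ∀ {N} → (Fin N → Fin N → Bool) → Fin N → Set
  IsMinimal R z = ∀ w → T (R w z) → w ≡ z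

  module _ {N : ℕ} (R : Fin N → Fin N → Bool)
           (R-refl : ∀ x → T (R x x))
           (R-antisym : ∀ x y → T (R x y) → T (R y x) → x ≡ y)
           (R-trans : ∀ x y z → T (R x y) → T (R y z) → T (R x z)) where

    private
      height : Fin N → ℕ
      height z = count (λ w → R w z) (allFin N)

      height-< : ∀ w z → T (R w z) → ¬ T (R z w) → height w < height z
      height-< w z wz ¬zw = ∑-mono-< (allFin N) (λ u → 𝟙-mono (λ uw → R-trans u w z uw wz)) (∈-allFin z)
        (subst₂ (λ a b → 𝟙 a < 𝟙 b) (sym (¬T⇒≡false ¬zw)) (sym (T⇒≡true (R-refl z))) (s≤s z≤n))

      minimal-below-acc : ∀ z → Acc (λ w z → height w < height z) z → ∃ λ w → T (R w z) × IsMinimal R w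
      minimal-below-acc z (acc rec) with T? (∀ᶠ N λ w → R w z ⇒ᵇ (w =ᶠ z))
      ... | yes minimal = z , R-refl z , λ w wz → =ᶠ-elim (T-⇒-elim (∀ᶠ-elim N minimal w) wz)
      ... | no ¬minimal with ∀ᶠ-counterexample N ¬minimal
      ... | w , ¬w⇒z with ¬T-⇒-elim {R w z} ¬w⇒z
      ... | wz , w≢z with minimal-below-acc w (rec (height-< w z wz (λ zw → w≢z (=ᶠ-intro (R-antisym w z wz zw)))))
      ... | v , vw , v-min = v , R-trans v w z vw wz , v-min

    minimal-below : ∀ z → ∃ λ w → T (R w z) × IsMinimal R w
    minimal-below z = minimal-below-acc z (On.wellFounded height ℕInd.<-wellFounded z)

  module _ (P : FinPoset) where
    private
      k = size P

    IsUp : Subset k → Set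
    IsUp U = ∀ x y → T (x ∈ˢ U) → T (leq P x y) → T (y ∈ˢ U)

    IsDown : Subset k → Set
    IsDown U = ∀ x y → T (x ∈ˢ U) → T (leq P y x) → T (y ∈ˢ U)

    isUpset-intro : ∀ U → IsUp U → T (isUpset P U)
    isUpset-intro U up = ∀ᶠ-intro k λ x → ∀ᶠ-intro k λ y → T-⇒-intro λ t → up x y (T-∧₁ t) (T-∧₂ {x ∈ˢ U} t)

    isUpset-elim : ∀ U → T (isUpset P U) → IsUp U
    isUpset-elim U t x y x∈U x≤y = T-⇒-elim (∀ᶠ-elim k (∀ᶠ-elim k t x) y) (T-∧-intro x∈U x≤y)

    isDownset-intro : ∀ U → IsDown U → T (isDownset P U)
    isDownset-intro U down = ∀ᶠ-intro k λ x → ∀ᶠ-intro k λ y → T-⇒-intro λ t → down x y (T-∧₁ t) (T-∧₂ {x ∈ˢ U} t)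

    isDownset-elim : ∀ U → T (isDownset P U) → IsDown U
    isDownset-elim U t x y x∈U y≤x = T-⇒-elim (∀ᶠ-elim k (∀ᶠ-elim k t x) y) (T-∧-intro x∈U y≤x)

  record InducedIso (P : FinPoset) (U : Subset (size P)) (Q : FinPoset) : Set where
    field
      embed           : Fin (size Q) → Fin (size P)
      embed-injective : ∀ a b → embed a ≡ embed b → a ≡ b
      embed-onto      : ∀ x → T (x ∈ˢ U) → ∃ λ a → embed a ≡ x
      embed-into      : ∀ a → T (embed a ∈ˢ U)
      embed-order     : ∀ a b → leq Q a b ≡ leq P (embed a) (embed b)

  module _ (P : FinPoset) (U : Subset (size P)) (Q : FinPoset) where
    private
      k = size P
      q = size Q

    inducedIso-elim : T (inducedIso P U Q) → InducedIso P U Q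
    inducedIso-elim t with Any.satisfied (any⁻ _ (allVecs (allFin k) q) t)
    ... | f , ok = record
      { embed           = lookup f
      ; embed-injective = λ a b e → =ᶠ-elim (T-⇒-elim (∀ᶠ-elim q (∀ᶠ-elim q injective a) b) (=ᶠ-intro e))
      ; embed-onto      = λ x x∈U → let (a , e) = ∃ᶠ-elim q (T-⇒-elim (T-∧₁ (∀ᶠ-elim k image x)) x∈U) in a , =ᶠ-elim e
      ; embed-into      = λ a → T-⇒-elim (T-∧₂ {(lookup f a ∈ˢ U) ⇒ᵇ _} (∀ᶠ-elim k image (lookup f a))) (∃ᶠ-intro q a (=ᶠ-intro refl))
      ; embed-order     = λ a b → ⇔ᵇ⇒≡ (∀ᶠ-elim q (∀ᶠ-elim q order a) b)
      }
      where
      injective = T-∧₁ ok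
      image = T-∧₁ (T-∧₂ {∀ᶠ q λ a → ∀ᶠ q λ b → (lookup f a =ᶠ lookup f b) ⇒ᵇ (a =ᶠ b)} ok)
      order = T-∧₂ {∀ᶠ k λ x → (x ∈ˢ U) ⇔ᵇ (∃ᶠ q λ a → lookup f a =ᶠ x)}
                   (T-∧₂ {∀ᶠ q λ a → ∀ᶠ q λ b → (lookup f a =ᶠ lookup f b) ⇒ᵇ (a =ᶠ b)} ok)

    inducedIso-intro : InducedIso P U Q → T (inducedIso P U Q)
    inducedIso-intro iso = any⁺ _ (lose (∈-allVecs ∈-allFin q f)
      (T-∧-intro (∀ᶠ-intro q λ a → ∀ᶠ-intro q λ b → T-⇒-intro λ e →
                    =ᶠ-intro (embed-injective a b (trans (sym (f≡ a)) (trans (=ᶠ-elim e) (f≡ b)))))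
      (T-∧-intro (∀ᶠ-intro k λ x → ≡⇒⇔ᵇ (bool-ext
                    (λ x∈U → let (a , e) = embed-onto x x∈U in ∃ᶠ-intro q a (=ᶠ-intro (trans (f≡ a) e)))
                    (λ t → let (a , e) = ∃ᶠ-elim q t in
                           subst (λ z → T (z ∈ˢ U)) (trans (sym (f≡ a)) (=ᶠ-elim e)) (embed-into a))))
                 (∀ᶠ-intro q λ a → ∀ᶠ-intro q λ b → ≡⇒⇔ᵇ (trans (embed-order a b) (sym (cong₂ (leq P) (f≡ a) (f≡ b))))))))
      where
      open InducedIso iso
      f = tabulate embed
      f≡ : ∀ a → lookup f a ≡ embed a
      f≡ = VecP.lookup∘tabulate embed

  module _ (P : FinPoset) (U : Subset (size P)) where

    inducedIso-unique : ∀ {Q Q′} → InducedIso P U Q → InducedIso P U Q′ → Q ≅ Q′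
    inducedIso-unique {Q} {Q′} ι ι′ = record
      { to        = to
      ; from      = from
      ; from∘to   = λ a → I.embed-injective _ _ (trans (embed∘from (to a)) (embed′∘to a))
      ; to∘from   = λ b → I′.embed-injective _ _ (trans (embed′∘to (from b)) (embed∘from b))
      ; preserves = λ a b → trans (I.embed-order a b)
                      (trans (cong₂ (leq P) (sym (embed′∘to a)) (sym (embed′∘to b))) (sym (I′.embed-order (to a) (to b))))
      }
      where
      module I = InducedIso ι
      module I′ = InducedIso ι′
      to : Fin (size Q) → Fin (size Q′)
      to a = proj₁ (I′.embed-onto (I.embed a) (I.embed-into a))
      embed′∘to : ∀ a → I′.embed (to a) ≡ I.embed a
      embed′∘to a = proj₂ (I′.embed-onto (I.embed a) (I.embed-into a))
      from : Fin (size Q′) → Fin (size Q)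
      from b = proj₁ (I.embed-onto (I′.embed b) (I′.embed-into b))
      embed∘from : ∀ b → I.embed (from b) ≡ I′.embed b
      embed∘from b = proj₂ (I.embed-onto (I′.embed b) (I′.embed-into b))

    inducedIso-resp-≅ : ∀ {Q Q′} → Q′ ≅ Q → InducedIso P U Q → InducedIso P U Q′
    inducedIso-resp-≅ φ ι = record
      { embed           = embed ∘ to
      ; embed-injective = λ a b e → trans (sym (from∘to a)) (trans (cong from (embed-injective _ _ e)) (from∘to b))
      ; embed-onto      = λ x x∈U → let (c , e) = embed-onto x x∈U in from c , trans (cong embed (to∘from c)) e
      ; embed-into      = embed-into ∘ to
      ; embed-order     = λ a b → trans (preserves a b) (embed-order (to a) (to b))
      }
      where
      open InducedIso ι
      open _≅_ φ

    total-inducedIso : (∀ x → T (x ∈ˢ U)) → InducedIso P U P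
    total-inducedIso total = record
      { embed = id ; embed-injective = λ _ _ e → e ; embed-onto = λ x _ → x , refl
      ; embed-into = total ; embed-order = λ _ _ → refl }

  card : ∀ {k} → Subset k → ℕ
  card [] = 0
  card (true ∷ U) = suc (card U)
  card (false ∷ U) = card U

  card-≤ : ∀ {k} (U : Subset k) → card U ≤ k
  card-≤ [] = z≤n
  card-≤ (true ∷ U) = s≤s (card-≤ U)
  card-≤ (false ∷ U) = ℕP.m≤n⇒m≤1+n (card-≤ U)

  card≡size⇒total : ∀ {k} (U : Subset k) → card U ≡ k → ∀ x → T (x ∈ˢ U)
  card≡size⇒total (true ∷ U) e F.zero = tt
  card≡size⇒total (true ∷ U) e (F.suc x) = card≡size⇒total U (ℕP.suc-injective e) x
  card≡size⇒total {suc k} (false ∷ U) e x = ⊥-elim (ℕP.<-irrefl refl (subst (_≤ k) e (card-≤ U)))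

  member : ∀ {k} (U : Subset k) → Fin (card U) → Fin k
  member (true ∷ U) F.zero = F.zero
  member (true ∷ U) (F.suc i) = F.suc (member U i)
  member (false ∷ U) i = F.suc (member U i)

  member-injective : ∀ {k} (U : Subset k) i j → member U i ≡ member U j → i ≡ j
  member-injective (true ∷ U) F.zero F.zero e = refl
  member-injective (true ∷ U) (F.suc i) (F.suc j) e = cong F.suc (member-injective U i j (FinP.suc-injective e))
  member-injective (false ∷ U) i j e = member-injective U i j (FinP.suc-injective e)

  member-∈ : ∀ {k} (U : Subset k) i → T (member U i ∈ˢ U)
  member-∈ (true ∷ U) F.zero = tt
  member-∈ (true ∷ U) (F.suc i) = member-∈ U i
  member-∈ (false ∷ U) i = member-∈ U i

  member-onto : ∀ {k} (U : Subset k) x → T (x ∈ˢ U) → ∃ λ i → member U i ≡ x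
  member-onto (true ∷ U) F.zero _ = F.zero , refl
  member-onto (true ∷ U) (F.suc x) x∈U = let (i , e) = member-onto U x x∈U in F.suc i , cong F.suc e
  member-onto (false ∷ U) (F.suc x) x∈U = let (i , e) = member-onto U x x∈U in i , cong F.suc e

  _∣_ : (P : FinPoset) → Subset (size P) → FinPoset
  P ∣ U = record
    { size    = card U
    ; leq     = λ a b → leq P (member U a) (member U b)
    ; refl    = λ a → FinPoset.refl P (member U a)
    ; antisym = λ a b a≤b b≤a → member-injective U a b (FinPoset.antisym P _ _ a≤b b≤a)
    ; trans   = λ a b c → FinPoset.trans P _ _ _
    }

  restriction-inducedIso : (P : FinPoset) (U : Subset (size P)) → InducedIso P U (P ∣ U)
  restriction-inducedIso P U = record
    { embed = member U ; embed-injective = member-injective U ; embed-onto = member-onto U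
    ; embed-into = member-∈ U ; embed-order = λ _ _ → refl }

  ≅⇒size≡ : ∀ {Q Q′} → Q ≅ Q′ → size Q ≡ size Q′
  ≅⇒size≡ φ = ↔⇒≡ (permutation to from to∘from from∘to)
    where open _≅_ φ

  inducedIso-size : (P : FinPoset) (U : Subset (size P)) {Q : FinPoset} → InducedIso P U Q → size Q ≡ card U
  inducedIso-size P U ι = ≅⇒size≡ (inducedIso-unique P U ι (restriction-inducedIso P U))

  module UpsetCovers (P : FinPoset) where
    private
      k = size P

    ⋃ : ∀ {m} → Vec (Subset k) m → Subset k
    ⋃ [] = ∅
    ⋃ (V ∷ Vs) = V ∪ ⋃ Vs

    allUpsets : ∀ {m} → Vec (Subset k) m → Bool
    allUpsets [] = true
    allUpsets (V ∷ Vs) = isUpset P V ∧ allUpsets Vs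

    covers : ∀ {m} → Subset k → Vec (Subset k) m → Bool
    covers U Vs = allUpsets Vs ∧ ⌊ ⋃ Vs ≟ˢ U ⌋

    upsetCovers : ℕ → Subset k → ℕ
    upsetCovers m U = count (covers U) (allVecs (allSubsets k) m)

    ∈-∪ : ∀ (V W : Subset k) x → (x ∈ˢ (V ∪ W)) ≡ (x ∈ˢ V) ∨ (x ∈ˢ W)
    ∈-∪ V W x = VecP.lookup-zipWith _∨_ x V W

    ∈-⋃⁻ : ∀ {m} (Vs : Vec (Subset k) m) x → T (x ∈ˢ ⋃ Vs) → ∃ λ i → T (x ∈ˢ lookup Vs i)
    ∈-⋃⁻ [] x t = ⊥-elim (subst T (VecP.lookup-replicate x false) t)
    ∈-⋃⁻ (V ∷ Vs) x t with Equivalence.to BoolP.T-∨ (subst T (∈-∪ V (⋃ Vs) x) t)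
    ... | inj₁ x∈V = F.zero , x∈V
    ... | inj₂ x∈⋃ = let (i , x∈Vᵢ) = ∈-⋃⁻ Vs x x∈⋃ in F.suc i , x∈Vᵢ

    ∈-⋃⁺ : ∀ {m} (Vs : Vec (Subset k) m) x i → T (x ∈ˢ lookup Vs i) → T (x ∈ˢ ⋃ Vs)
    ∈-⋃⁺ (V ∷ Vs) x F.zero t = subst T (sym (∈-∪ V (⋃ Vs) x)) (Equivalence.from BoolP.T-∨ (inj₁ t))
    ∈-⋃⁺ (V ∷ Vs) x (F.suc i) t = subst T (sym (∈-∪ V (⋃ Vs) x)) (Equivalence.from BoolP.T-∨ (inj₂ (∈-⋃⁺ Vs x i t)))

    allUpsets-elim : ∀ {m} (Vs : Vec (Subset k) m) → T (allUpsets Vs) → ∀ i → IsUp P (lookup Vs i)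
    allUpsets-elim (V ∷ Vs) t F.zero = isUpset-elim P V (T-∧₁ t)
    allUpsets-elim (V ∷ Vs) t (F.suc i) = allUpsets-elim Vs (T-∧₂ {isUpset P V} t) i

    allUpsets-intro : ∀ {m} (Vs : Vec (Subset k) m) → (∀ i → IsUp P (lookup Vs i)) → T (allUpsets Vs)
    allUpsets-intro [] _ = tt
    allUpsets-intro (V ∷ Vs) up = T-∧-intro (isUpset-intro P V (up F.zero)) (allUpsets-intro Vs (up ∘ F.suc))

    ⋃-isUp : ∀ {m} (Vs : Vec (Subset k) m) → T (allUpsets Vs) → IsUp P (⋃ Vs)
    ⋃-isUp Vs t x y x∈⋃ x≤y = let (i , x∈Vᵢ) = ∈-⋃⁻ Vs x x∈⋃ in ∈-⋃⁺ Vs y i (allUpsets-elim Vs t i x y x∈Vᵢ x≤y)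

    covers⇒isUp : ∀ {m} U (Vs : Vec (Subset k) m) → T (covers U Vs) → IsUp P U
    covers⇒isUp U Vs t = subst (IsUp P) (toWitness {a? = ⋃ Vs ≟ˢ U} (T-∧₂ {allUpsets Vs} t)) (⋃-isUp Vs (T-∧₁ t))

  module ExtensionsAsCovers (P : FinPoset) (U : Subset (size P)) (Q : FinPoset)
                            (U-up : IsUp P U) (ι : InducedIso P U Q) (m : ℕ) where
    open UpsetCovers P
    open InducedIso ι
    private
      k = size P
      q = size Q
      N = m + q

    Relation : Set
    Relation = Vec (Vec Bool N) N

    rel : Relation → Fin N → Fin N → Bool
    rel R x y = lookup (lookup R x) y

    -- Verbatim the condition counted by eNum m Q; the first m points form M.
    isExtension : Relation → Bool
    isExtension R =
        (∀ᶠ N λ x → rel R x x)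
      ∧ (∀ᶠ N λ x → ∀ᶠ N λ y → (rel R x y ∧ rel R y x) ⇒ᵇ (x =ᶠ y))
      ∧ (∀ᶠ N λ x → ∀ᶠ N λ y → ∀ᶠ N λ z → (rel R x y ∧ rel R y z) ⇒ᵇ rel R x z)
      ∧ (∀ᶠ q λ a → ∀ᶠ q λ b → rel R (m ↑ʳ a) (m ↑ʳ b) ⇔ᵇ leq Q a b)
      ∧ (∀ᶠ N λ z → (∀ᶠ N λ w → rel R w z ⇒ᵇ (w =ᶠ z)) ⇔ᵇ (toℕ z ℕ.<ᵇ m))

    record Extension (R : Relation) : Set where
      field
        reflexive     : ∀ x → T (rel R x x)
        antisymmetric : ∀ x y → T (rel R x y) → T (rel R y x) → x ≡ y
        transitive    : ∀ x y z → T (rel R x y) → T (rel R y z) → T (rel R x z)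
        restricts     : ∀ a b → rel R (m ↑ʳ a) (m ↑ʳ b) ≡ leq Q a b
        minimal⇒new   : ∀ z → IsMinimal (rel R) z → toℕ z < m
        new⇒minimal   : ∀ z → toℕ z < m → IsMinimal (rel R) z

    isExtension-elim : ∀ R → T (isExtension R) → Extension R
    isExtension-elim R t = record
      { reflexive     = ∀ᶠ-elim N t₁
      ; antisymmetric = λ x y r s → =ᶠ-elim (T-⇒-elim (∀ᶠ-elim N (∀ᶠ-elim N t₂ x) y) (T-∧-intro r s))
      ; transitive    = λ x y z r s → T-⇒-elim (∀ᶠ-elim N (∀ᶠ-elim N (∀ᶠ-elim N t₃ x) y) z) (T-∧-intro r s)
      ; restricts     = λ a b → ⇔ᵇ⇒≡ (∀ᶠ-elim q (∀ᶠ-elim q t₄ a) b)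
      ; minimal⇒new   = λ z min → ℕP.<ᵇ⇒< (toℕ z) m (T-⇒-elim (T-∧₁ (∀ᶠ-elim N t₅ z))
                          (∀ᶠ-intro N λ w → T-⇒-intro λ r → =ᶠ-intro (min w r)))
      ; new⇒minimal   = λ z z<m w r → =ᶠ-elim (T-⇒-elim (∀ᶠ-elim N
                          (T-⇒-elim (T-∧₂ {(∀ᶠ N λ w → rel R w z ⇒ᵇ (w =ᶠ z)) ⇒ᵇ _} (∀ᶠ-elim N t₅ z)) (ℕP.<⇒<ᵇ z<m)) w) r)
      }
      where
      t₁ = T-∧₁ t
      r₁ = T-∧₂ {∀ᶠ N λ x → rel R x x} t
      t₂ = T-∧₁ r₁
      r₂ = T-∧₂ {∀ᶠ N λ x → ∀ᶠ N λ y → (rel R x y ∧ rel R y x) ⇒ᵇ (x =ᶠ y)} r₁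
      t₃ = T-∧₁ r₂
      r₃ = T-∧₂ {∀ᶠ N λ x → ∀ᶠ N λ y → ∀ᶠ N λ z → (rel R x y ∧ rel R y z) ⇒ᵇ rel R x z} r₂
      t₄ = T-∧₁ r₃
      t₅ = T-∧₂ {∀ᶠ q λ a → ∀ᶠ q λ b → rel R (m ↑ʳ a) (m ↑ʳ b) ⇔ᵇ leq Q a b} r₃

    isExtension-intro : ∀ R → Extension R → T (isExtension R)
    isExtension-intro R extension =
      T-∧-intro (∀ᶠ-intro N reflexive)
      (T-∧-intro (∀ᶠ-intro N λ x → ∀ᶠ-intro N λ y → T-⇒-intro λ t → =ᶠ-intro (antisymmetric x y (T-∧₁ t) (T-∧₂ {rel R x y} t)))
      (T-∧-intro (∀ᶠ-intro N λ x → ∀ᶠ-intro N λ y → ∀ᶠ-intro N λ z → T-⇒-intro λ t → transitive x y z (T-∧₁ t) (T-∧₂ {rel R x y} t))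
      (T-∧-intro (∀ᶠ-intro q λ a → ∀ᶠ-intro q λ b → ≡⇒⇔ᵇ (restricts a b))
      (∀ᶠ-intro N λ z → ≡⇒⇔ᵇ (bool-ext
         (λ t → ℕP.<⇒<ᵇ (minimal⇒new z (λ w r → =ᶠ-elim (T-⇒-elim (∀ᶠ-elim N t w) r))))
         (λ z<m → ∀ᶠ-intro N λ w → T-⇒-intro λ r → =ᶠ-intro (new⇒minimal z (ℕP.<ᵇ⇒< (toℕ z) m z<m) w r)))))))
      where open Extension extension

    data Side : Fin N → Set where
      new : ∀ i → Side (i ↑ˡ q)
      old : ∀ a → Side (m ↑ʳ a)

    side : ∀ x → Side x
    side x with F.splitAt m x in e
    ... | inj₁ i = subst Side (FinP.splitAt⁻¹-↑ˡ e) (new i)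
    ... | inj₂ a = subst Side (FinP.splitAt⁻¹-↑ʳ e) (old a)

    new<m : ∀ (i : Fin m) → toℕ (i ↑ˡ q) < m
    new<m i = subst (_< m) (sym (FinP.toℕ-↑ˡ i q)) (FinP.toℕ<n i)

    old≮m : ∀ (a : Fin q) → ¬ toℕ (m ↑ʳ a) < m
    old≮m a lt = ℕP.<-irrefl refl (ℕP.<-≤-trans lt (subst (m ≤_) (sym (FinP.toℕ-↑ʳ m a)) (ℕP.m≤m+n m (toℕ a))))

    new≢old : ∀ i a → i ↑ˡ q ≢ m ↑ʳ a
    new≢old i a e = old≮m a (subst (λ z → toℕ z < m) e (new<m i))

    aboveSets : Relation → Vec (Subset k) m
    aboveSets R = tabulate λ i → tabulate λ x → ∃ᶠ q λ a → (embed a =ᶠ x) ∧ rel R (i ↑ˡ q) (m ↑ʳ a)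

    ∈-aboveSets : ∀ R i x → (x ∈ˢ lookup (aboveSets R) i) ≡ (∃ᶠ q λ a → (embed a =ᶠ x) ∧ rel R (i ↑ˡ q) (m ↑ʳ a))
    ∈-aboveSets R i x = trans (cong (λ v → lookup v x) (VecP.lookup∘tabulate _ i)) (VecP.lookup∘tabulate _ x)

    block : Vec (Subset k) m → Fin m ⊎ Fin q → Fin m ⊎ Fin q → Bool
    block Vs (inj₁ i) (inj₁ j) = i =ᶠ j
    block Vs (inj₁ i) (inj₂ b) = embed b ∈ˢ lookup Vs i
    block Vs (inj₂ a) (inj₁ j) = false
    block Vs (inj₂ a) (inj₂ b) = leq Q a b

    blockOrder : Vec (Subset k) m → Relation
    blockOrder Vs = tabulate λ x → tabulate λ y → block Vs (F.splitAt m x) (F.splitAt m y)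

    private
      rel-blockOrder : ∀ Vs x y → rel (blockOrder Vs) x y ≡ block Vs (F.splitAt m x) (F.splitAt m y)
      rel-blockOrder Vs x y = trans (cong (λ v → lookup v y) (VecP.lookup∘tabulate _ x)) (VecP.lookup∘tabulate _ y)

    blockOrder-new-new : ∀ Vs i j → rel (blockOrder Vs) (i ↑ˡ q) (j ↑ˡ q) ≡ (i =ᶠ j)
    blockOrder-new-new Vs i j = trans (rel-blockOrder Vs _ _) (cong₂ (block Vs) (FinP.splitAt-↑ˡ m i q) (FinP.splitAt-↑ˡ m j q))

    blockOrder-new-old : ∀ Vs i b → rel (blockOrder Vs) (i ↑ˡ q) (m ↑ʳ b) ≡ (embed b ∈ˢ lookup Vs i)
    blockOrder-new-old Vs i b = trans (rel-blockOrder Vs _ _) (cong₂ (block Vs) (FinP.splitAt-↑ˡ m i q) (FinP.splitAt-↑ʳ m q b))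

    blockOrder-old-new : ∀ Vs a j → rel (blockOrder Vs) (m ↑ʳ a) (j ↑ˡ q) ≡ false
    blockOrder-old-new Vs a j = trans (rel-blockOrder Vs _ _) (cong₂ (block Vs) (FinP.splitAt-↑ʳ m q a) (FinP.splitAt-↑ˡ m j q))

    blockOrder-old-old : ∀ Vs a b → rel (blockOrder Vs) (m ↑ʳ a) (m ↑ʳ b) ≡ leq Q a b
    blockOrder-old-old Vs a b = trans (rel-blockOrder Vs _ _) (cong₂ (block Vs) (FinP.splitAt-↑ʳ m q a) (FinP.splitAt-↑ʳ m q b))

    -- Every old point lies above a minimal point, and minimal points are new: this makes the sets cover U.
    aboveSets-covers : ∀ R → T (isExtension R) → T (covers U (aboveSets R))
    aboveSets-covers R t = T-∧-intro (allUpsets-intro (aboveSets R) aboveSets-up) (fromWitness (vec-ext ⋃≡U))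
      where
      open Extension (isExtension-elim R t)
      ∈-above⁻ : ∀ i x → T (x ∈ˢ lookup (aboveSets R) i) → ∃ λ a → embed a ≡ x × T (rel R (i ↑ˡ q) (m ↑ʳ a))
      ∈-above⁻ i x x∈ with ∃ᶠ-elim q (subst T (∈-aboveSets R i x) x∈)
      ... | a , s = a , =ᶠ-elim (T-∧₁ s) , T-∧₂ {embed a =ᶠ x} s
      ∈-above⁺ : ∀ i a → T (rel R (i ↑ˡ q) (m ↑ʳ a)) → T (embed a ∈ˢ lookup (aboveSets R) i)
      ∈-above⁺ i a r = subst T (sym (∈-aboveSets R i (embed a))) (∃ᶠ-intro q a (T-∧-intro (=ᶠ-intro refl) r))
      aboveSets-up : ∀ i → IsUp P (lookup (aboveSets R) i)
      aboveSets-up i x y x∈ x≤y with ∈-above⁻ i x x∈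
      ... | a , refl , r with embed-onto y (U-up (embed a) y (embed-into a) x≤y)
      ... | b , refl = ∈-above⁺ i b (transitive _ _ _ r (subst T (sym (trans (restricts a b) (embed-order a b))) x≤y))
      minimal-below-old : ∀ a w → Side w → T (rel R w (m ↑ʳ a)) → IsMinimal (rel R) w → T (embed a ∈ˢ ⋃ (aboveSets R))
      minimal-below-old a _ (new i) r _ = ∈-⋃⁺ (aboveSets R) (embed a) i (∈-above⁺ i a r)
      minimal-below-old a _ (old c) r min = ⊥-elim (old≮m c (minimal⇒new _ min))
      ⋃≡U : ∀ x → lookup (⋃ (aboveSets R)) x ≡ lookup U x
      ⋃≡U x = bool-ext
        (λ x∈⋃ → let (i , x∈Vᵢ) = ∈-⋃⁻ (aboveSets R) x x∈⋃ ; (a , e , _) = ∈-above⁻ i x x∈Vᵢ in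
                 subst (λ z → T (z ∈ˢ U)) e (embed-into a))
        (λ x∈U → let (a , e) = embed-onto x x∈U ; (w , w≤a , w-min) = minimal-below (rel R) reflexive antisymmetric transitive (m ↑ʳ a) in
                 subst (λ z → T (z ∈ˢ ⋃ (aboveSets R))) e (minimal-below-old a w (side w) w≤a w-min))

    blockOrder-isExtension : ∀ Vs → T (covers U Vs) → T (isExtension (blockOrder Vs))
    blockOrder-isExtension Vs t = isExtension-intro (blockOrder Vs) record
      { reflexive     = λ x → reflexive′ (side x)
      ; antisymmetric = λ x y → antisymmetric′ (side x) (side y)
      ; transitive    = λ x y z → transitive′ (side x) (side y) (side z)
      ; restricts     = blockOrder-old-old Vs
      ; minimal⇒new   = λ z → minimal⇒new′ (side z)
      ; new⇒minimal   = λ z z<m w → new⇒minimal′ (side z) (side w) z<m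
      }
      where
      Vs-up = allUpsets-elim Vs (T-∧₁ t)
      ⋃≡U : ⋃ Vs ≡ U
      ⋃≡U = toWitness {a? = ⋃ Vs ≟ˢ U} (T-∧₂ {allUpsets Vs} t)
      R = rel (blockOrder Vs)
      n-n = blockOrder-new-new Vs
      n-o = blockOrder-new-old Vs
      o-n = blockOrder-old-new Vs
      o-o = blockOrder-old-old Vs
      reflexive′ : ∀ {x} → Side x → T (R x x)
      reflexive′ (new i) = subst T (sym (n-n i i)) (=ᶠ-intro refl)
      reflexive′ (old a) = subst T (sym (o-o a a)) (FinPoset.refl Q a)
      antisymmetric′ : ∀ {x y} → Side x → Side y → T (R x y) → T (R y x) → x ≡ y
      antisymmetric′ (new i) (new j) r _ = cong (_↑ˡ q) (=ᶠ-elim (subst T (n-n i j) r))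
      antisymmetric′ (new i) (old b) _ s = ⊥-elim (subst T (o-n b i) s)
      antisymmetric′ (old a) (new j) r _ = ⊥-elim (subst T (o-n a j) r)
      antisymmetric′ (old a) (old b) r s = cong (m ↑ʳ_) (FinPoset.antisym Q a b (subst T (o-o a b) r) (subst T (o-o b a) s))
      transitive′ : ∀ {x y z} → Side x → Side y → Side z → T (R x y) → T (R y z) → T (R x z)
      transitive′ (new i) (new j) _ r s with refl ← =ᶠ-elim (subst T (n-n i j) r) = s
      transitive′ (new i) (old b) (new c) _ s = ⊥-elim (subst T (o-n b c) s)
      transitive′ (new i) (old b) (old c) r s =
        subst T (sym (n-o i c)) (Vs-up i (embed b) (embed c) (subst T (n-o i b) r) (subst T (trans (o-o b c) (embed-order b c)) s))
      transitive′ (old a) (new j) _ r _ = ⊥-elim (subst T (o-n a j) r)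
      transitive′ (old a) (old b) (new c) _ s = ⊥-elim (subst T (o-n b c) s)
      transitive′ (old a) (old b) (old c) r s =
        subst T (sym (o-o a c)) (FinPoset.trans Q a b c (subst T (o-o a b) r) (subst T (o-o b c) s))
      minimal⇒new′ : ∀ {z} → Side z → IsMinimal R z → toℕ z < m
      minimal⇒new′ (new i) _ = new<m i
      minimal⇒new′ (old a) min with ∈-⋃⁻ Vs (embed a) (subst (λ V → T (embed a ∈ˢ V)) (sym ⋃≡U) (embed-into a))
      ... | i , a∈Vᵢ = ⊥-elim (new≢old i a (min (i ↑ˡ q) (subst T (sym (n-o i a)) a∈Vᵢ)))
      new⇒minimal′ : ∀ {z w} → Side z → Side w → toℕ z < m → T (R w z) → w ≡ z
      new⇒minimal′ (old a) _ z<m _ = ⊥-elim (old≮m a z<m)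
      new⇒minimal′ (new j) (new i) _ r = cong (_↑ˡ q) (=ᶠ-elim (subst T (n-n i j) r))
      new⇒minimal′ (new j) (old a) _ r = ⊥-elim (subst T (o-n a j) r)

    blockOrder∘aboveSets : ∀ R → T (isExtension R) → blockOrder (aboveSets R) ≡ R
    blockOrder∘aboveSets R t = vec-ext λ x → vec-ext λ y → same (side x) (side y)
      where
      open Extension (isExtension-elim R t)
      same : ∀ {x y} → Side x → Side y → rel (blockOrder (aboveSets R)) x y ≡ rel R x y
      same (new i) (new j) = trans (blockOrder-new-new _ i j) (bool-ext
        (λ e → subst (λ j′ → T (rel R (i ↑ˡ q) (j′ ↑ˡ q))) (=ᶠ-elim e) (reflexive _))
        (λ r → =ᶠ-intro (FinP.↑ˡ-injective q i j (new⇒minimal (j ↑ˡ q) (new<m j) (i ↑ˡ q) r))))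
      same (new i) (old b) = trans (blockOrder-new-old _ i b) (trans (∈-aboveSets R i (embed b)) (bool-ext
        (λ t′ → let (a , s) = ∃ᶠ-elim q t′ in
                subst (λ a′ → T (rel R (i ↑ˡ q) (m ↑ʳ a′))) (embed-injective a b (=ᶠ-elim (T-∧₁ s))) (T-∧₂ {embed a =ᶠ embed b} s))
        (λ r → ∃ᶠ-intro q b (T-∧-intro (=ᶠ-intro refl) r))))
      same (old a) (new j) = trans (blockOrder-old-new _ a j)
        (sym (¬T⇒≡false λ r → new≢old j a (sym (new⇒minimal (j ↑ˡ q) (new<m j) (m ↑ʳ a) r))))
      same (old a) (old b) = trans (blockOrder-old-old _ a b) (sym (restricts a b))

    aboveSets∘blockOrder : ∀ Vs → T (covers U Vs) → aboveSets (blockOrder Vs) ≡ Vs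
    aboveSets∘blockOrder Vs t = vec-ext λ i → vec-ext λ x → trans (∈-aboveSets (blockOrder Vs) i x) (bool-ext
      (λ t′ → let (a , s) = ∃ᶠ-elim q t′ in
              subst (λ z → T (z ∈ˢ lookup Vs i)) (=ᶠ-elim (T-∧₁ s)) (subst T (blockOrder-new-old Vs i a) (T-∧₂ {embed a =ᶠ x} s)))
      (λ x∈Vᵢ → let (a , e) = embed-onto x (subst (λ V → T (x ∈ˢ V)) ⋃≡U (∈-⋃⁺ Vs x i x∈Vᵢ)) in
                ∃ᶠ-intro q a (T-∧-intro (=ᶠ-intro e)
                  (subst T (sym (blockOrder-new-old Vs i a)) (subst (λ z → T (z ∈ˢ lookup Vs i)) (sym e) x∈Vᵢ)))))
      where
      ⋃≡U : ⋃ Vs ≡ U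
      ⋃≡U = toWitness {a? = ⋃ Vs ≟ˢ U} (T-∧₂ {allUpsets Vs} t)

    extensions≡upsetCovers : eNum m Q ≡ upsetCovers m U
    extensions≡upsetCovers = count-bijection (VecP.≡-dec _≟ˢ_) (VecP.≡-dec _≟ˢ_)
      (allVecs (allSubsets N) N) (allVecs (allSubsets k) m)
      (enumerates-allVecs _≟ˢ_ (enumerates-allSubsets N) N)
      (enumerates-allVecs _≟ˢ_ (enumerates-allSubsets k) m)
      isExtension (covers U) aboveSets blockOrder
      aboveSets-covers blockOrder-isExtension blockOrder∘aboveSets aboveSets∘blockOrder

  count-none : {A : Set} (p : A → Bool) (xs : List A) → (∀ x → ¬ T (p x)) → count p xs ≡ 0
  count-none p xs none = trans (∑-cong xs (λ x → cong 𝟙 (¬T⇒≡false (none x)))) (∑-zero xs)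

  module _ {k : ℕ} where

    ∈-∁ : ∀ (V : Subset k) x → (x ∈ˢ ∁ V) ≡ not (x ∈ˢ V)
    ∈-∁ V x = VecP.lookup-map x not V

    ∈-∁⁺ : ∀ (V : Subset k) x → ¬ T (x ∈ˢ V) → T (x ∈ˢ ∁ V)
    ∈-∁⁺ V x x∉V = subst T (sym (∈-∁ V x)) (T-not-intro x∉V)

    ∈-∁⁻ : ∀ (V : Subset k) x → T (x ∈ˢ ∁ V) → ¬ T (x ∈ˢ V)
    ∈-∁⁻ V x x∈∁V = T-not-elim (subst T (∈-∁ V x) x∈∁V)

    ∁-involutive : ∀ (V : Subset k) → ∁ (∁ V) ≡ V
    ∁-involutive V = vec-ext λ x → trans (∈-∁ (∁ V) x) (trans (cong not (∈-∁ V x)) (BoolP.not-involutive _))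

    ∈-⊤ : ∀ x → T (x ∈ˢ ⊤ {k})
    ∈-⊤ x = subst T (sym (VecP.lookup-replicate x true)) tt

    ∪≡⊤-intro : ∀ (V W : Subset k) → (∀ x → ¬ T (x ∈ˢ W) → T (x ∈ˢ V)) → V ∪ W ≡ ⊤
    ∪≡⊤-intro V W h = vec-ext λ x → trans (VecP.lookup-zipWith _∨_ x V W)
      (trans (T⇒≡true (Equivalence.from BoolP.T-∨ (in-either x))) (sym (VecP.lookup-replicate x true)))
      where
      in-either : ∀ x → T (x ∈ˢ V) ⊎ T (x ∈ˢ W)
      in-either x with T? (x ∈ˢ W)
      ... | yes x∈W = inj₂ x∈W
      ... | no x∉W = inj₁ (h x x∉W)

    ∪≡⊤-elim : ∀ (V W : Subset k) → V ∪ W ≡ ⊤ → ∀ x → ¬ T (x ∈ˢ W) → T (x ∈ˢ V)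
    ∪≡⊤-elim V W V∪W≡⊤ x x∉W with Equivalence.to BoolP.T-∨
      (subst T (trans (cong (λ S → x ∈ˢ S) (sym V∪W≡⊤)) (VecP.lookup-zipWith _∨_ x V W)) (∈-⊤ x))
    ... | inj₁ x∈V = x∈V
    ... | inj₂ x∈W = ⊥-elim (x∉W x∈W)

  module CoverCounts (P : FinPoset) where
    open UpsetCovers P
    private
      k = size P
      subsets = allSubsets k

    #upsets : ℕ
    #upsets = count (isUpset P) subsets

    #upsets≡downsetNumber : #upsets ≡ downsetNumber P
    #upsets≡downsetNumber = count-bijection _≟ˢ_ _≟ˢ_ subsets subsets (enumerates-allSubsets k) (enumerates-allSubsets k)
      (isUpset P) (isDownset P) ∁ ∁
      (λ V up → isDownset-intro P (∁ V) λ x y x∈∁V y≤x → ∈-∁⁺ V y λ y∈V → ∈-∁⁻ V x x∈∁V (isUpset-elim P V up y x y∈V y≤x))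
      (λ V down → isUpset-intro P (∁ V) λ x y x∈∁V x≤y → ∈-∁⁺ V y λ y∈V → ∈-∁⁻ V x x∈∁V (isDownset-elim P V down y x y∈V x≤y))
      (λ V _ → ∁-involutive V) (λ V _ → ∁-involutive V)

    #upset-tuples : ∀ m → count allUpsets (allVecs subsets m) ≡ #upsets ^ m
    #upset-tuples zero = refl
    #upset-tuples (suc m) = begin
      count allUpsets (allVecs subsets (suc m))
        ≡⟨ ∑-allVecs-suc subsets m _ ⟩
      ∑[ V ∈ subsets ] ∑[ Vs ∈ allVecs subsets m ] 𝟙 (isUpset P V ∧ allUpsets Vs)
        ≡⟨ ∑-cong subsets (λ V → ∑-cong (allVecs subsets m) (𝟙-∧ (isUpset P V) ∘ allUpsets)) ⟩
      ∑[ V ∈ subsets ] ∑[ Vs ∈ allVecs subsets m ] (𝟙 (isUpset P V) * 𝟙 (allUpsets Vs))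
        ≡⟨ ∑-cong subsets (λ V → ∑-*ˡ (allVecs subsets m) (𝟙 (isUpset P V)) (𝟙 ∘ allUpsets)) ⟩
      ∑[ V ∈ subsets ] (𝟙 (isUpset P V) * count allUpsets (allVecs subsets m))
        ≡⟨ ∑-*ʳ subsets _ (𝟙 ∘ isUpset P) ⟩
      #upsets * count allUpsets (allVecs subsets m)
        ≡⟨ cong (#upsets *_) (#upset-tuples m) ⟩
      #upsets * #upsets ^ m ∎
      where open ≡-Reasoning

    -- Every tuple of upsets covers exactly one set, its union.
    ∑-upsetCovers : ∀ m → ∑[ U ∈ subsets ] upsetCovers m U ≡ downsetNumber P ^ m
    ∑-upsetCovers m = begin
      ∑[ U ∈ subsets ] upsetCovers m U
        ≡⟨ ∑-comm subsets tuples _ ⟩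
      ∑[ Vs ∈ tuples ] ∑[ U ∈ subsets ] 𝟙 (covers U Vs)
        ≡⟨ ∑-cong tuples (λ Vs → ∑-cong subsets (covers-split Vs)) ⟩
      ∑[ Vs ∈ tuples ] ∑[ U ∈ subsets ] (𝟙 ⌊ ⋃ Vs ≟ˢ U ⌋ * 𝟙 (allUpsets Vs))
        ≡⟨ ∑-cong tuples (λ Vs → ∑-select _≟ˢ_ subsets (enumerates-allSubsets k) (⋃ Vs) _) ⟩
      count allUpsets tuples
        ≡⟨ #upset-tuples m ⟩
      #upsets ^ m
        ≡⟨ cong (_^ m) #upsets≡downsetNumber ⟩
      downsetNumber P ^ m ∎
      where
      open ≡-Reasoning
      tuples = allVecs subsets m
      covers-split : ∀ Vs U → 𝟙 (covers U Vs) ≡ 𝟙 ⌊ ⋃ Vs ≟ˢ U ⌋ * 𝟙 (allUpsets Vs)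
      covers-split Vs U = trans (𝟙-∧ (allUpsets Vs) _) (ℕP.*-comm (𝟙 (allUpsets Vs)) _)

    upsetCovers-nonUpset : ∀ m U → ¬ T (isUpset P U) → upsetCovers m U ≡ 0
    upsetCovers-nonUpset m U ¬up = count-none (covers U) (allVecs subsets m) λ Vs t → ¬up (isUpset-intro P U (covers⇒isUp U Vs t))

    inCirc-elim : ∀ U y → T (inCirc P U y) → ∀ x → ¬ T (x ∈ˢ U) → ¬ T (leq P x y)
    inCirc-elim U y y∈U° x x∉U x≤y = T-not-elim y∈U° (∃ᶠ-intro k x (T-∧-intro (T-not-intro x∉U) x≤y))

    inCirc-witness : ∀ U y → ¬ T (inCirc P U y) → ∃ λ x → ¬ T (x ∈ˢ U) × T (leq P x y)
    inCirc-witness U y y∉U° with T? (∃ᶠ k λ x → not (x ∈ˢ U) ∧ leq P x y)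
    ... | yes t = let (x , s) = ∃ᶠ-elim k t in x , T-not-elim (T-∧₁ s) , T-∧₂ {not (x ∈ˢ U)} s
    ... | no ¬t = ⊥-elim (y∉U° (T-not-intro ¬t))

    complements : Subset k → Subset k → Bool
    complements U V = isUpset P V ∧ ⌊ V ∪ U ≟ˢ ⊤ ⌋

    -- Verbatim the predicate counted by dCirc P U.
    isCircDownset : Subset k → Subset k → Bool
    isCircDownset U S = (∀ᶠ k λ x → (x ∈ˢ S) ⇒ᵇ inCirc P U x)
      ∧ (∀ᶠ k λ x → ∀ᶠ k λ y → ((x ∈ˢ S) ∧ inCirc P U y ∧ leq P y x) ⇒ᵇ (y ∈ˢ S))

    -- V ↦ ∁ V: an upset V with V ∪ U = K is the complement of a downset of U°.
    #complements≡dCirc : ∀ U → count (complements U) subsets ≡ dCirc P U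
    #complements≡dCirc U = count-bijection _≟ˢ_ _≟ˢ_ subsets subsets (enumerates-allSubsets k) (enumerates-allSubsets k)
      (complements U) (isCircDownset U) ∁ ∁ to from (λ V _ → ∁-involutive V) (λ V _ → ∁-involutive V)
      where
      to : ∀ V → T (complements U V) → T (isCircDownset U (∁ V))
      to V t = T-∧-intro
        (∀ᶠ-intro k λ y → T-⇒-intro λ y∈∁V → inCirc-intro y λ x x∉U x≤y →
           ∈-∁⁻ V y y∈∁V (isUpset-elim P V V-up x y (∪≡⊤-elim V U V∪U≡⊤ x x∉U) x≤y))
        (∀ᶠ-intro k λ x → ∀ᶠ-intro k λ y → T-⇒-intro λ s → ∈-∁⁺ V y λ y∈V →
           ∈-∁⁻ V x (T-∧₁ s) (isUpset-elim P V V-up y x y∈V (T-∧₂ {inCirc P U y} (T-∧₂ {x ∈ˢ ∁ V} s))))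
        where
        V-up = T-∧₁ t
        V∪U≡⊤ = toWitness {a? = V ∪ U ≟ˢ ⊤} (T-∧₂ {isUpset P V} t)
        inCirc-intro : ∀ y → (∀ x → ¬ T (x ∈ˢ U) → ¬ T (leq P x y)) → T (inCirc P U y)
        inCirc-intro y h = T-not-intro λ t → let (x , s) = ∃ᶠ-elim k t in h x (T-not-elim (T-∧₁ s)) (T-∧₂ {not (x ∈ˢ U)} s)
      from : ∀ S → T (isCircDownset U S) → T (complements U (∁ S))
      from S t = T-∧-intro
        (isUpset-intro P (∁ S) λ x y x∈∁S x≤y → ∈-∁⁺ S y λ y∈S → ∁S-up x y x∈∁S x≤y y∈S (T-⇒-elim (∀ᶠ-elim k S⊆U° y) y∈S))
        (fromWitness (∪≡⊤-intro (∁ S) U λ x x∉U → ∈-∁⁺ S x λ x∈S →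
           inCirc-elim U x (T-⇒-elim (∀ᶠ-elim k S⊆U° x) x∈S) x x∉U (FinPoset.refl P x)))
        where
        S⊆U° = T-∧₁ t
        S-down = T-∧₂ {∀ᶠ k λ x → (x ∈ˢ S) ⇒ᵇ inCirc P U x} t
        ∁S-up : ∀ x y → T (x ∈ˢ ∁ S) → T (leq P x y) → T (y ∈ˢ S) → T (inCirc P U y) → ⊥
        ∁S-up x y x∈∁S x≤y y∈S y∈U° with T? (inCirc P U x)
        ... | yes x∈U° = ∈-∁⁻ S x x∈∁S (T-⇒-elim (∀ᶠ-elim k (∀ᶠ-elim k S-down y) x) (T-∧-intro y∈S (T-∧-intro x∈U° x≤y)))
        ... | no x∉U° = let (z , z∉U , z≤x) = inCirc-witness U x x∉U° in
                        inCirc-elim U y y∈U° z z∉U (FinPoset.trans P z x y z≤x x≤y)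

    -- Splitting off the first upset V of a tuple covering K: the rest covers some U with V ∪ U = K.
    upsetCovers-suc : ∀ m → upsetCovers (suc m) ⊤ ≡ ∑[ U ∈ subsets ] (dCirc P U * upsetCovers m U)
    upsetCovers-suc m = begin
      upsetCovers (suc m) ⊤
        ≡⟨ ∑-allVecs-suc subsets m _ ⟩
      ∑[ V ∈ subsets ] ∑[ Vs ∈ tuples ] 𝟙 (covers ⊤ (V ∷ Vs))
        ≡⟨ ∑-cong subsets (λ V → ∑-cong tuples (split V)) ⟩
      ∑[ V ∈ subsets ] ∑[ Vs ∈ tuples ] ∑[ U ∈ subsets ] term V Vs U
        ≡⟨ ∑-cong subsets (λ V → ∑-comm tuples subsets (term V)) ⟩
      ∑[ V ∈ subsets ] ∑[ U ∈ subsets ] ∑[ Vs ∈ tuples ] term V Vs U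
        ≡⟨ ∑-comm subsets subsets _ ⟩
      ∑[ U ∈ subsets ] ∑[ V ∈ subsets ] ∑[ Vs ∈ tuples ] term V Vs U
        ≡⟨ ∑-cong subsets (λ U → ∑-cong subsets (λ V →
            ∑-*ʳ tuples (𝟙 (complements U V)) (𝟙 ∘ covers U))) ⟩
      ∑[ U ∈ subsets ] ∑[ V ∈ subsets ] (upsetCovers m U * 𝟙 (complements U V))
        ≡⟨ ∑-cong subsets (λ U → ∑-*ˡ subsets (upsetCovers m U) _) ⟩
      ∑[ U ∈ subsets ] (upsetCovers m U * count (complements U) subsets)
        ≡⟨ ∑-cong subsets (λ U →
            trans (cong (upsetCovers m U *_) (#complements≡dCirc U))
            (ℕP.*-comm (upsetCovers m U) (dCirc P U))) ⟩
      ∑[ U ∈ subsets ] (dCirc P U * upsetCovers m U) ∎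
      where
      open ≡-Reasoning
      tuples = allVecs subsets m
      term : Subset k → Vec (Subset k) m → Subset k → ℕ
      term V Vs U = 𝟙 (covers U Vs) * 𝟙 (complements U V)
      ∧-shuffle : ∀ a b c → (a ∧ b) ∧ c ≡ b ∧ (a ∧ c)
      ∧-shuffle true b c = refl
      ∧-shuffle false true c = refl
      ∧-shuffle false false c = refl
      split : ∀ V Vs → 𝟙 (covers ⊤ (V ∷ Vs)) ≡ ∑[ U ∈ subsets ] term V Vs U
      split V Vs = begin
        𝟙 (covers ⊤ (V ∷ Vs))
          ≡⟨ cong 𝟙 (∧-shuffle (isUpset P V) (allUpsets Vs) _) ⟩
        𝟙 (allUpsets Vs ∧ complements (⋃ Vs) V)
          ≡⟨ 𝟙-∧ (allUpsets Vs) _ ⟩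
        𝟙 (allUpsets Vs) * 𝟙 (complements (⋃ Vs) V)
          ≡⟨ ∑-select _≟ˢ_ subsets (enumerates-allSubsets k) (⋃ Vs) _ ⟨
        ∑[ U ∈ subsets ] (𝟙 ⌊ ⋃ Vs ≟ˢ U ⌋ * (𝟙 (allUpsets Vs) * 𝟙 (complements U V)))
          ≡⟨ ∑-cong subsets reassociate ⟩
        ∑[ U ∈ subsets ] term V Vs U ∎
        where
        reassociate : ∀ U → 𝟙 ⌊ ⋃ Vs ≟ˢ U ⌋ * (𝟙 (allUpsets Vs) * 𝟙 (complements U V)) ≡ term V Vs U
        reassociate U = begin
          𝟙 ⌊ ⋃ Vs ≟ˢ U ⌋ * (𝟙 (allUpsets Vs) * 𝟙 (complements U V))
            ≡⟨ ℕP.*-assoc (𝟙 ⌊ ⋃ Vs ≟ˢ U ⌋) _ _ ⟨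
          𝟙 ⌊ ⋃ Vs ≟ˢ U ⌋ * 𝟙 (allUpsets Vs) * 𝟙 (complements U V)
            ≡⟨ cong (_* 𝟙 (complements U V))
                (trans (ℕP.*-comm (𝟙 ⌊ ⋃ Vs ≟ˢ U ⌋) _) (sym (𝟙-∧ (allUpsets Vs) _))) ⟩
          term V Vs U ∎

open Combinatorics

open import Data.Integer using (_+_; _*_; _-_)

Σ₁-cong : ∀ N {f g : ℕ → ℤ} → (∀ j → 1 ≤ j → j ≤ N → f j ≡ g j) → Σ₁ N f ≡ Σ₁ N g
Σ₁-cong zero _ = refl
Σ₁-cong (suc N) f≗g = cong₂ _+_ (Σ₁-cong N λ j 1≤j j≤N → f≗g j 1≤j (ℕP.m≤n⇒m≤1+n j≤N)) (f≗g (suc N) (s≤s z≤n) ℕP.≤-refl)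

Σ₁-zero : ∀ N {f : ℕ → ℤ} → (∀ j → 1 ≤ j → j ≤ N → f j ≡ + 0) → Σ₁ N f ≡ + 0
Σ₁-zero N f≗0 = trans (Σ₁-cong N f≗0) (Σ₁-const-zero N)
  where
  Σ₁-const-zero : ∀ N → Σ₁ N (λ _ → + 0) ≡ + 0
  Σ₁-const-zero zero = refl
  Σ₁-const-zero (suc N) = cong (_+ + 0) (Σ₁-const-zero N)

Σ₁-single : ∀ N (f : ℕ → ℤ) i → 1 ≤ i → i ≤ N → (∀ j → 1 ≤ j → j ≤ N → j ≢ i → f j ≡ + 0) → Σ₁ N f ≡ f i
Σ₁-single zero f .zero () z≤n _
Σ₁-single (suc N) f i 1≤i i≤1+N others with i ℕ.≟ suc N
... | yes refl = trans (cong (_+ f (suc N)) (Σ₁-zero N λ j 1≤j j≤N → others j 1≤j (ℕP.m≤n⇒m≤1+n j≤N) (ℕP.<⇒≢ (s≤s j≤N))))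
                       (ℤP.+-identityˡ (f (suc N)))
... | no i≢1+N = trans (cong₂ _+_ (Σ₁-single N f i 1≤i (ℕP.≤-pred (ℕP.≤∧≢⇒< i≤1+N i≢1+N))
                                      λ j 1≤j j≤N → others j 1≤j (ℕP.m≤n⇒m≤1+n j≤N))
                                   (others (suc N) (s≤s z≤n) ℕP.≤-refl (i≢1+N ∘ sym)))
                       (ℤP.+-identityʳ (f i))

Σ₁-extend : ∀ N N′ (f : ℕ → ℤ) → N ≤ N′ → (∀ j → N < j → j ≤ N′ → f j ≡ + 0) → Σ₁ N′ f ≡ Σ₁ N f
Σ₁-extend N zero f z≤n _ = refl
Σ₁-extend N (suc N′) f N≤1+N′ tail≗0 with N ℕ.≟ suc N′
... | yes refl = refl
... | no N≢1+N′ = trans (cong₂ _+_ (Σ₁-extend N N′ f (ℕP.≤-pred N<1+N′) λ j N<j j≤N′ → tail≗0 j N<j (ℕP.m≤n⇒m≤1+n j≤N′))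
                                    (tail≗0 (suc N′) N<1+N′ ℕP.≤-refl))
                        (ℤP.+-identityʳ (Σ₁ N f))
  where N<1+N′ = ℕP.≤∧≢⇒< N≤1+N′ N≢1+N′

Σ₁-+ : ∀ N (f g : ℕ → ℤ) → Σ₁ N (λ j → f j + g j) ≡ Σ₁ N f + Σ₁ N g
Σ₁-+ zero f g = refl
Σ₁-+ (suc N) f g = trans (cong (_+ (f (suc N) + g (suc N))) (Σ₁-+ N f g)) (interchange (Σ₁ N f) (Σ₁ N g) (f (suc N)) (g (suc N)))
  where open import Algebra.Properties.CommutativeSemigroup ℤP.+-commutativeSemigroup using (interchange)

Σ₁-*ˡ : ∀ N (c : ℤ) (f : ℕ → ℤ) → Σ₁ N (λ j → c * f j) ≡ c * Σ₁ N f
Σ₁-*ˡ zero c f = sym (ℤP.*-zeroʳ c)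
Σ₁-*ˡ (suc N) c f = trans (cong (_+ c * f (suc N)) (Σ₁-*ˡ N c f)) (sym (ℤP.*-distribˡ-+ c (Σ₁ N f) (f (suc N))))

Σ₁-*ʳ : ∀ N (c : ℤ) (f : ℕ → ℤ) → Σ₁ N (λ j → f j * c) ≡ Σ₁ N f * c
Σ₁-*ʳ zero c f = refl
Σ₁-*ʳ (suc N) c f = trans (cong (_+ f (suc N) * c) (Σ₁-*ʳ N c f)) (sym (ℤP.*-distribʳ-+ c (Σ₁ N f) (f (suc N))))

Σ₁-comm : ∀ N M (f : ℕ → ℕ → ℤ) → Σ₁ N (λ i → Σ₁ M (λ j → f i j)) ≡ Σ₁ M (λ j → Σ₁ N (λ i → f i j))
Σ₁-comm zero M f = sym (Σ₁-zero M λ _ _ _ → refl)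
Σ₁-comm (suc N) M f = trans (cong (_+ Σ₁ M (f (suc N))) (Σ₁-comm N M f)) (sym (Σ₁-+ M _ _))

Σ₁-∑ : ∀ N {A : Set} (xs : List A) (f : ℕ → A → ℕ) (c : A → ℕ) →
  (∀ x → Σ₁ N (λ j → + f j x) ≡ + c x) → Σ₁ N (λ j → + ∑ xs (f j)) ≡ + ∑ xs c
Σ₁-∑ N [] f c _ = Σ₁-zero N λ _ _ _ → refl
Σ₁-∑ N (x ∷ xs) f c Σf≡c = begin
  Σ₁ N (λ j → + (f j x ℕ.+ ∑ xs (f j)))            ≡⟨ Σ₁-cong N (λ j _ _ → ℤP.pos-+ (f j x) (∑ xs (f j))) ⟩
  Σ₁ N (λ j → + f j x + + ∑ xs (f j))              ≡⟨ Σ₁-+ N _ _ ⟩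
  Σ₁ N (λ j → + f j x) + Σ₁ N (λ j → + ∑ xs (f j)) ≡⟨ cong₂ _+_ (Σf≡c x) (Σ₁-∑ N xs f c Σf≡c) ⟩
  + c x + + ∑ xs c                                 ≡⟨ ℤP.pos-+ (c x) (∑ xs c) ⟨
  + (c x ℕ.+ ∑ xs c)                               ∎
  where open ≡-Reasoning

Σ[]-split : ∀ a b (f : ℕ → ℤ) → a ≤ b → Σ₁ b f ≡ Σ₁ a f + Σ[ suc a , b ] f
Σ[]-split a b f a≤b = begin
  Σ₁ b f
    ≡⟨ cong (λ n → Σ₁ n f) (ℕP.m+[n∸m]≡n a≤b) ⟨
  Σ₁ (a ℕ.+ (b ∸ a)) f
    ≡⟨ shift a (b ∸ a) ⟩
  Σ₁ a f + Σ₁ (b ∸ a) (λ i → f (i ℕ.+ a))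
    ≡⟨ cong (λ s → Σ₁ a f + s) (Σ₁-cong (b ∸ a) λ i _ _ → cong f (sym (cong (_∸ 1) (ℕP.+-suc i a)))) ⟩
  Σ₁ a f + Σ[ suc a , b ] f ∎
  where
  open ≡-Reasoning
  shift : ∀ c d → Σ₁ (c ℕ.+ d) f ≡ Σ₁ c f + Σ₁ d (λ i → f (i ℕ.+ c))
  shift c zero = trans (cong (λ n → Σ₁ n f) (ℕP.+-identityʳ c)) (sym (ℤP.+-identityʳ _))
  shift c (suc d) = begin
    Σ₁ (c ℕ.+ suc d) f                                  ≡⟨ cong (λ n → Σ₁ n f) (ℕP.+-suc c d) ⟩
    Σ₁ (c ℕ.+ d) f + f (suc (c ℕ.+ d))                  ≡⟨ cong₂ _+_ (shift c d) (cong (f ∘ suc) (ℕP.+-comm c d)) ⟩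
    Σ₁ c f + Σ₁ d (λ i → f (i ℕ.+ c)) + f (suc d ℕ.+ c) ≡⟨ ℤP.+-assoc (Σ₁ c f) _ _ ⟩
    Σ₁ c f + Σ₁ (suc d) (λ i → f (i ℕ.+ c))             ∎

Σ[]-cong : ∀ a b {f g : ℕ → ℤ} → (∀ j → suc a ≤ j → j ≤ b → f j ≡ g j) → Σ[ suc a , b ] f ≡ Σ[ suc a , b ] g
Σ[]-cong a b {f} {g} f≗g = Σ₁-cong (b ∸ a) λ i 1≤i i≤b∸a →
  let j≡ = cong (_∸ 1) (ℕP.+-suc i a) in
  trans (cong f j≡) (trans (f≗g (i ℕ.+ a) (ℕP.+-monoˡ-≤ a 1≤i) (in-range i 1≤i i≤b∸a)) (sym (cong g j≡)))
  where
  in-range : ∀ i → 1 ≤ i → i ≤ b ∸ a → i ℕ.+ a ≤ b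
  in-range i 1≤i i≤b∸a with a ℕ.≤? b
  ... | yes a≤b = ℕP.≤-trans (ℕP.+-monoˡ-≤ a i≤b∸a) (ℕP.≤-reflexive (ℕP.m∸n+n≡m a≤b))
  ... | no a≰b = ⊥-elim (ℕP.<-irrefl refl (ℕP.≤-trans 1≤i (ℕP.≤-trans i≤b∸a (ℕP.≤-reflexive (ℕP.m≤n⇒m∸n≡0 (ℕP.<⇒≤ (ℕP.≰⇒> a≰b)))))))

Σ[]-empty : ∀ a b (f : ℕ → ℤ) → b < a → Σ[ a , b ] f ≡ + 0
Σ[]-empty a b f b<a = cong (λ n → Σ₁ n (λ i → f (i ℕ.+ a ∸ 1))) (ℕP.m≤n⇒m∸n≡0 b<a)

δ-diag : ∀ n → δ n n ≡ + 1
δ-diag n = cong (λ b → if b then + 1 else + 0) (T⇒≡true (fromWitness {a? = n ℕ.≟ n} refl))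

δ-off : ∀ m n → m ≢ n → δ m n ≡ + 0
δ-off m n m≢n = cong (λ b → if b then + 1 else + 0) (¬T⇒≡false (m≢n ∘ toWitness {a? = m ℕ.≟ n}))

upperTriangular-productIs : ∀ X Y Z → UpperTriangular Y →
  (∀ m n → 1 ≤ m → 1 ≤ n → Σ₁ n (λ j → X m j * Y j n) ≡ Z m n) → ProductIs X Y Z
upperTriangular-productIs X Y Z Y-upper XY≡Z m n 1≤m 1≤n = n , λ N n≤N →
  trans (Σ₁-extend n N _ n≤N λ j n<j _ → trans (cong (X m j *_) (Y-upper j n 1≤n n<j)) (ℤP.*-zeroʳ (X m j)))
        (XY≡Z m n 1≤m 1≤n)

module MatrixIdentities (P : ℕ → FinPoset) (enum : IsEnumeration P) where
  open IsEnumeration enum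

  inducedIso-index-≤ : ∀ n j → 1 ≤ n → 1 ≤ j → ∀ U → InducedIso (P n) U (P j) → j ≤ n
  inducedIso-index-≤ n j 1≤n 1≤j U ι with j ℕ.≤? n
  ... | yes j≤n = j≤n
  ... | no j≰n = ⊥-elim (ℕP.<⇒≢ (ℕP.≰⇒> j≰n) (sym j≡n))
    where
    -- P_j is at least as large as P_n, so U is all of P_n and P_j ≅ P_n.
    card≡size : card U ≡ size (P n)
    card≡size = ℕP.≤-antisym (card-≤ U)
      (subst (size (P n) ≤_) (inducedIso-size (P n) U ι) (sizeMono n j 1≤n (ℕP.<⇒≤ (ℕP.≰⇒> j≰n))))
    j≡n : j ≡ n
    j≡n = distinct j n 1≤j 1≤n (inducedIso-unique (P n) U ι (total-inducedIso (P n) U (card≡size⇒total U card≡size)))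

  inducedIso-index : ∀ n U → ∃ λ j → 1 ≤ j × InducedIso (P n) U (P j)
  inducedIso-index n U with complete (P n ∣ U)
  ... | j , 1≤j , Pj≅ = j , 1≤j , inducedIso-resp-≅ (P n) U Pj≅ (restriction-inducedIso (P n) U)

  Σ₁-over-index : ∀ n → 1 ≤ n → ∀ U (h : ℕ → ℕ) c → (∀ j → 1 ≤ j → InducedIso (P n) U (P j) → h j ≡ c) →
    Σ₁ n (λ j → + (if inducedIso (P n) U (P j) then h j else 0)) ≡ + c
  Σ₁-over-index n 1≤n U h c h≡c with inducedIso-index n U
  ... | i , 1≤i , ι = trans (Σ₁-single n _ i 1≤i (inducedIso-index-≤ n i 1≤n 1≤i U ι) other-index)
                            (cong +_ (trans (cong (λ b → if b then h i else 0) U≅Pᵢ) (h≡c i 1≤i ι)))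
    where
    U≅Pᵢ = T⇒≡true (inducedIso-intro (P n) U (P i) ι)
    other-index : ∀ j → 1 ≤ j → j ≤ n → j ≢ i → + (if inducedIso (P n) U (P j) then h j else 0) ≡ + 0
    other-index j 1≤j _ j≢i with inducedIso (P n) U (P j) in eq
    ... | true = ⊥-elim (j≢i (distinct j i 1≤j 1≤i
                   (inducedIso-unique (P n) U (inducedIso-elim (P n) U (P j) (subst T (sym eq) tt)) ι)))
    ... | false = refl

  open Matrices P

  -- Group the upsets U of P_n by the index j of P_n|_U; on each group e(m, P_j) = T_m(U) by the key bijection.
  E-times-weighted-upsets : ∀ m n → 1 ≤ n → (w : Subset (size (P n)) → ℕ) →
    Σ₁ n (λ j → E m j * + ∑[ U ∈ allSubsets (size (P n)) ] (if isUpset (P n) U ∧ inducedIso (P n) U (P j) then w U else 0))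
    ≡ + ∑[ U ∈ allSubsets (size (P n)) ] (w U ℕ.* UpsetCovers.upsetCovers (P n) m U)
  E-times-weighted-upsets m n 1≤n w = begin
    Σ₁ n (λ j → E m j * + ∑[ U ∈ subsets ] g j U)
      ≡⟨ Σ₁-cong n (λ j _ _ → sym (ℤP.pos-* (e j) _)) ⟩
    Σ₁ n (λ j → + (e j ℕ.* ∑[ U ∈ subsets ] g j U))
      ≡⟨ Σ₁-cong n (λ j _ _ → cong +_ (sym (∑-*ˡ subsets (e j) (g j)))) ⟩
    Σ₁ n (λ j → + ∑[ U ∈ subsets ] (e j ℕ.* g j U))
      ≡⟨ Σ₁-∑ n subsets _ _ at-upset ⟩
    + ∑[ U ∈ subsets ] (w U ℕ.* upsetCovers m U) ∎
    where
    open ≡-Reasoning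
    open UpsetCovers (P n)
    open CoverCounts (P n)
    subsets = allSubsets (size (P n))
    e : ℕ → ℕ
    e j = eNum m (P j)
    g : ℕ → Subset (size (P n)) → ℕ
    g j U = if isUpset (P n) U ∧ inducedIso (P n) U (P j) then w U else 0
    at-upset : ∀ U → Σ₁ n (λ j → + (e j ℕ.* g j U)) ≡ + (w U ℕ.* upsetCovers m U)
    at-upset U with isUpset (P n) U in up
    ... | true = trans (Σ₁-cong n λ j _ _ → cong +_ (*-if (e j) (inducedIso (P n) U (P j)) (w U)))
                       (Σ₁-over-index n 1≤n U (λ j → e j ℕ.* w U) (w U ℕ.* upsetCovers m U) λ j _ ι →
                          trans (cong (ℕ._* w U) (ExtensionsAsCovers.extensions≡upsetCovers (P n) U (P j)
                                                    (isUpset-elim (P n) U (subst T (sym up) tt)) ι m))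
                                (ℕP.*-comm (upsetCovers m U) (w U)))
    ... | false = trans (Σ₁-zero n λ j _ _ → cong +_ (ℕP.*-zeroʳ (e j)))
                        (cong +_ (sym (trans (cong (w U ℕ.*_) (upsetCovers-nonUpset m U (subst T up)))
                                             (ℕP.*-zeroʳ (w U)))))

  E-times-B : ∀ m n → 1 ≤ m → 1 ≤ n → Σ₁ n (λ j → E m j * B j n) ≡ D m n
  E-times-B m n _ 1≤n = trans (E-times-weighted-upsets m n 1≤n (λ _ → 1)) (cong +_ (begin
    ∑[ U ∈ allSubsets (size (P n)) ] (1 ℕ.* upsetCovers m U)
      ≡⟨ ∑-cong (allSubsets (size (P n))) (λ U → ℕP.*-identityˡ (upsetCovers m U)) ⟩
    ∑[ U ∈ allSubsets (size (P n)) ] upsetCovers m U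
      ≡⟨ ∑-upsetCovers m ⟩
    downsetNumber (P n) ^ m ∎))
    where
    open ≡-Reasoning
    open UpsetCovers (P n)
    open CoverCounts (P n)

  E-times-A : ∀ m n → 1 ≤ m → 1 ≤ n → Σ₁ n (λ j → E m j * A j n) ≡ E (suc m) n
  E-times-A m n _ 1≤n = trans (E-times-weighted-upsets m n 1≤n (dCirc (P n))) (cong +_ (begin
    ∑[ U ∈ allSubsets (size (P n)) ] (dCirc (P n) U ℕ.* upsetCovers m U)
      ≡⟨ upsetCovers-suc m ⟨
    upsetCovers (suc m) ⊤
      ≡⟨ ExtensionsAsCovers.extensions≡upsetCovers (P n) ⊤ (P n)
          (λ _ y _ _ → ∈-⊤ y) (total-inducedIso (P n) ⊤ ∈-⊤) (suc m) ⟨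
    eNum (suc m) (P n) ∎))
    where
    open ≡-Reasoning
    open UpsetCovers (P n)
    open CoverCounts (P n)

  no-upset-of-larger-index : ∀ m n → 1 ≤ n → n < m → ∀ U → ¬ T (isUpset (P n) U ∧ inducedIso (P n) U (P m))
  no-upset-of-larger-index m n 1≤n n<m U t = ℕP.<⇒≱ n<m
    (inducedIso-index-≤ n m 1≤n (ℕP.≤-trans 1≤n (ℕP.<⇒≤ n<m)) U (inducedIso-elim (P n) U (P m) (T-∧₂ {isUpset (P n) U} t)))

  B-upper : UpperTriangular B
  B-upper m n 1≤n n<m = cong +_ (count-none _ (allSubsets (size (P n))) (no-upset-of-larger-index m n 1≤n n<m))

  A-upper : UpperTriangular A
  A-upper m n 1≤n n<m = cong +_ (trans (∑-cong (allSubsets (size (P n))) λ U →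
      cong (λ b → if b then dCirc (P n) U else 0) (¬T⇒≡false (no-upset-of-larger-index m n 1≤n n<m U)))
    (∑-zero (allSubsets (size (P n)))))

  -- Only the whole of P_n is an upset inducing a copy of P_n.
  B-diag : ∀ n → B n n ≡ + 1
  B-diag n = cong +_ (trans (∑-cong subsets λ U → trans (cong 𝟙 (bool-ext (whole U) (whole⁻¹ U))) (sym (ℕP.*-identityʳ _)))
                            (∑-select _≟ˢ_ subsets (enumerates-allSubsets k) ⊤ (λ _ → 1)))
    where
    k = size (P n)
    subsets = allSubsets k
    whole : ∀ U → T (isUpset (P n) U ∧ inducedIso (P n) U (P n)) → T ⌊ ⊤ ≟ˢ U ⌋
    whole U t = fromWitness (vec-ext λ x → trans (VecP.lookup-replicate x true) (sym (T⇒≡true (total x))))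
      where
      total = card≡size⇒total U (sym (inducedIso-size (P n) U (inducedIso-elim (P n) U (P n) (T-∧₂ {isUpset (P n) U} t))))
    whole⁻¹ : ∀ U → T ⌊ ⊤ ≟ˢ U ⌋ → T (isUpset (P n) U ∧ inducedIso (P n) U (P n))
    whole⁻¹ U t with refl ← toWitness {a? = ⊤ ≟ˢ U} t =
      T-∧-intro (isUpset-intro (P n) ⊤ λ _ y _ _ → ∈-⊤ y) (inducedIso-intro (P n) ⊤ (P n) (total-inducedIso (P n) ⊤ ∈-⊤))

  cFuel-stable : ∀ f f′ j n → n ∸ j < f → n ∸ j < f′ → cFuel f j n ≡ cFuel f′ j n
  cFuel-stable (suc f) (suc f′) j n n∸j<1+f n∸j<1+f′ = cong (δ j n -_) (Σ[]-cong j n λ i j<i i≤n →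
      cong (B j i *_) (cFuel-stable f f′ i n (shrink n∸j<1+f j<i i≤n) (shrink n∸j<1+f′ j<i i≤n)))
    where
    shrink : ∀ {g i} → n ∸ j < suc g → suc j ≤ i → i ≤ n → n ∸ i < g
    shrink n∸j<1+g j<i i≤n = ℕP.<-≤-trans (ℕP.∸-monoʳ-< j<i i≤n) (ℕP.≤-pred n∸j<1+g)

  C-recursion : ∀ j n → C j n ≡ δ j n - Σ[ suc j , n ] (λ i → B j i * C i n)
  C-recursion j n = cong (δ j n -_) (Σ[]-cong j n λ i j<i i≤n →
    cong (B j i *_) (cFuel-stable (n ∸ j) (suc (n ∸ i)) i n (ℕP.∸-monoʳ-< j<i i≤n) (ℕP.n<1+n _)))

  C-upper : UpperTriangular C
  C-upper m n _ n<m = trans (cong (δ m n -_) (Σ[]-empty (suc m) n (λ j → B m j * cFuel (n ∸ m) j n) (ℕP.m≤n⇒m≤1+n n<m)))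
                            (cong (_- + 0) (δ-off m n (ℕP.<⇒≢ n<m ∘ sym)))

  C-diag : ∀ n → C n n ≡ + 1
  C-diag n = trans (cong (δ n n -_) (Σ[]-empty (suc n) n (λ j → B n j * cFuel (n ∸ n) j n) (ℕP.n<1+n n))) (cong (_- + 0) (δ-diag n))

  B-times-C : ∀ m n → 1 ≤ m → 1 ≤ n → Σ₁ n (λ j → B m j * C j n) ≡ δ m n
  B-times-C m n 1≤m 1≤n with m ℕ.≤? n
  ... | no m≰n = trans (Σ₁-zero n λ j 1≤j j≤n → trans (cong (_* C j n) (B-upper m j 1≤j (ℕP.≤-<-trans j≤n (ℕP.≰⇒> m≰n))))
                                                      (ℤP.*-zeroˡ (C j n)))
                       (sym (δ-off m n (ℕP.<⇒≢ (ℕP.≰⇒> m≰n) ∘ sym)))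
  B-times-C m@(suc m′) n _ _ | yes m≤n = begin
    Σ₁ n g
      ≡⟨ Σ[]-split m n g m≤n ⟩
    Σ₁ m′ g + g m + rest
      ≡⟨ cong (λ s → s + g m + rest) (Σ₁-zero m′ λ j 1≤j j≤m′ →
          trans (cong (_* C j n) (B-upper m j 1≤j (s≤s j≤m′))) (ℤP.*-zeroˡ (C j n))) ⟩
    + 0 + B m m * C m n + rest
      ≡⟨ cong (λ b → + 0 + b * C m n + rest) (B-diag m) ⟩
    + 0 + + 1 * C m n + rest
      ≡⟨ cong (_+ rest) (trans (ℤP.+-identityˡ _) (ℤP.*-identityˡ (C m n))) ⟩
    C m n + rest
      ≡⟨ cong (_+ rest) (C-recursion m n) ⟩
    δ m n - rest + rest
      ≡⟨ solve 2 (λ d r → d :- r :+ r := d) refl (δ m n) rest ⟩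
    δ m n ∎
    where
    open ≡-Reasoning
    open +-*-Solver
    g : ℕ → ℤ
    g j = B m j * C j n
    rest = Σ[ suc m , n ] g

  row-times-B-truncate : ∀ (e : ℕ → ℤ) j n → 1 ≤ j → j ≤ n → Σ₁ n (λ i → e i * B i j) ≡ Σ₁ j (λ i → e i * B i j)
  row-times-B-truncate e j n 1≤j j≤n = Σ₁-extend j n _ j≤n λ i j<i _ → trans (cong (e i *_) (B-upper i j 1≤j j<i)) (ℤP.*-zeroʳ (e i))

  row-times-B-times-C : ∀ n → 1 ≤ n → (e : ℕ → ℤ) → Σ₁ n (λ j → Σ₁ n (λ i → e i * B i j) * C j n) ≡ e n
  row-times-B-times-C n 1≤n e = begin
    Σ₁ n (λ j → Σ₁ n (λ i → e i * B i j) * C j n)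
      ≡⟨ Σ₁-cong n (λ j _ _ → sym (Σ₁-*ʳ n (C j n) (λ i → e i * B i j))) ⟩
    Σ₁ n (λ j → Σ₁ n (λ i → e i * B i j * C j n))
      ≡⟨ Σ₁-comm n n _ ⟩
    Σ₁ n (λ i → Σ₁ n (λ j → e i * B i j * C j n))
      ≡⟨ Σ₁-cong n (λ i _ _ → trans (Σ₁-cong n λ j _ _ → ℤP.*-assoc (e i) (B i j) (C j n))
          (Σ₁-*ˡ n (e i) (λ j → B i j * C j n))) ⟩
    Σ₁ n (λ i → e i * Σ₁ n (λ j → B i j * C j n))
      ≡⟨ Σ₁-cong n (λ i 1≤i _ → cong (e i *_) (B-times-C i n 1≤i 1≤n)) ⟩
    Σ₁ n (λ i → e i * δ i n)
      ≡⟨ Σ₁-single n _ n 1≤n ℕP.≤-refl (λ i _ _ i≢n →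
          trans (cong (e i *_) (δ-off i n i≢n)) (ℤP.*-zeroʳ (e i))) ⟩
    e n * δ n n
      ≡⟨ cong (e n *_) (δ-diag n) ⟩
    e n * + 1
      ≡⟨ ℤP.*-identityʳ (e n) ⟩
    e n ∎
    where open ≡-Reasoning

  D-times-C : ∀ m n → 1 ≤ m → 1 ≤ n → Σ₁ n (λ j → D m j * C j n) ≡ E m n
  D-times-C m n 1≤m 1≤n = trans (Σ₁-cong n λ j 1≤j j≤n → cong (_* C j n)
                                   (trans (sym (E-times-B m j 1≤m 1≤j)) (sym (row-times-B-truncate (E m) j n 1≤j j≤n))))
                                (row-times-B-times-C n 1≤n (E m))

  δ-times-C : ∀ m n → 1 ≤ m → 1 ≤ n → Σ₁ n (λ j → δ m j * C j n) ≡ C m n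
  δ-times-C m n 1≤m 1≤n with m ℕ.≤? n
  ... | yes m≤n = trans (Σ₁-single n _ m 1≤m m≤n λ j _ _ j≢m → trans (cong (_* C j n) (δ-off m j (j≢m ∘ sym))) (ℤP.*-zeroˡ (C j n)))
                        (trans (cong (_* C m n) (δ-diag m)) (ℤP.*-identityˡ (C m n)))
  ... | no m≰n = trans (Σ₁-zero n λ j _ j≤n → trans (cong (_* C j n) (δ-off m j (ℕP.<⇒≢ (ℕP.≤-<-trans j≤n (ℕP.≰⇒> m≰n)) ∘ sym)))
                                                    (ℤP.*-zeroˡ (C j n)))
                       (sym (C-upper m n 1≤n (ℕP.≰⇒> m≰n)))

  -- A right inverse of the unitriangular B is also a left inverse: (C B − I) C = C B C − C = 0, and C is unitriangular.
  C-times-B-column : ∀ m → 1 ≤ m → ∀ n j → 1 ≤ j → j ≤ n → Σ₁ j (λ i → C m i * B i j) ≡ δ m j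
  C-times-B-column m 1≤m zero .zero () z≤n
  C-times-B-column m 1≤m (suc n) j 1≤j j≤1+n with j ℕ.≟ suc n
  ... | no j≢1+n = C-times-B-column m 1≤m n j 1≤j (ℕP.≤-pred (ℕP.≤∧≢⇒< j≤1+n j≢1+n))
  ... | yes refl = begin
    X (suc n)                       ≡⟨ ℤP.*-identityʳ (X (suc n)) ⟨
    X (suc n) * + 1                 ≡⟨ cong (X (suc n) *_) (C-diag (suc n)) ⟨
    X (suc n) * C (suc n) (suc n)   ≡⟨ ∙-cancelˡ (Σ₁ n (λ j → δ m j * C j (suc n))) _ _ last-terms ⟩
    δ m (suc n) * C (suc n) (suc n) ≡⟨ cong (δ m (suc n) *_) (C-diag (suc n)) ⟩
    δ m (suc n) * + 1               ≡⟨ ℤP.*-identityʳ (δ m (suc n)) ⟩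
    δ m (suc n)                     ∎
    where
    open ≡-Reasoning
    open import Algebra.Properties.AbelianGroup ℤP.+-0-abelianGroup using (∙-cancelˡ)
    X : ℕ → ℤ
    X j = Σ₁ j (λ i → C m i * B i j)
    earlier : Σ₁ n (λ j → X j * C j (suc n)) ≡ Σ₁ n (λ j → δ m j * C j (suc n))
    earlier = Σ₁-cong n λ j 1≤j j≤n → cong (_* C j (suc n)) (C-times-B-column m 1≤m n j 1≤j j≤n)
    whole : Σ₁ (suc n) (λ j → X j * C j (suc n)) ≡ Σ₁ (suc n) (λ j → δ m j * C j (suc n))
    whole = begin
      Σ₁ (suc n) (λ j → X j * C j (suc n))
        ≡⟨ Σ₁-cong (suc n) (λ j 1≤j j≤1+n → cong (_* C j (suc n))
            (sym (row-times-B-truncate (C m) j (suc n) 1≤j j≤1+n))) ⟩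
      Σ₁ (suc n) (λ j → Σ₁ (suc n) (λ i → C m i * B i j) * C j (suc n))
        ≡⟨ row-times-B-times-C (suc n) (s≤s z≤n) (C m) ⟩
      C m (suc n)
        ≡⟨ δ-times-C m (suc n) 1≤m (s≤s z≤n) ⟨
      Σ₁ (suc n) (λ j → δ m j * C j (suc n)) ∎
    last-terms : Σ₁ n (λ j → δ m j * C j (suc n)) + X (suc n) * C (suc n) (suc n)
               ≡ Σ₁ n (λ j → δ m j * C j (suc n)) + δ m (suc n) * C (suc n) (suc n)
    last-terms = trans (cong (_+ X (suc n) * C (suc n) (suc n)) (sym earlier)) whole

  C-times-B : ∀ m n → 1 ≤ m → 1 ≤ n → Σ₁ n (λ j → C m j * B j n) ≡ δ m n
  C-times-B m n 1≤m 1≤n = C-times-B-column m 1≤m n n 1≤n ℕP.≤-refl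

  Ī-times-E : ProductIs Ī E (λ m n → E (suc m) n)
  Ī-times-E m n _ _ = suc m , λ N 1+m≤N →
    trans (Σ₁-single N _ (suc m) (s≤s z≤n) 1+m≤N λ j _ _ j≢1+m →
             trans (cong (_* E j n) (δ-off (suc m) j (j≢1+m ∘ sym))) (ℤP.*-zeroˡ (E j n)))
          (trans (cong (_* E (suc m) n) (δ-diag (suc m))) (ℤP.*-identityˡ (E (suc m) n)))

theorem5p3 : (P : ℕ → FinPoset) → IsEnumeration P →
    let open Matrices P in
      (UpperTriangular A × UpperTriangular B × UpperTriangular C)
    × (ProductIs B C I × ProductIs C B I)
    × (ProductIs E B D × ProductIs D C E)
    × (ProductIs E A (λ m n → E (suc m) n) × ProductIs Ī E (λ m n → E (suc m) n))
theorem5p3 P enum =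
    (A-upper , B-upper , C-upper)
  , (upperTriangular-productIs B C I C-upper B-times-C , upperTriangular-productIs C B I B-upper C-times-B)
  , (upperTriangular-productIs E B D B-upper E-times-B , upperTriangular-productIs D C E C-upper D-times-C)
  , (upperTriangular-productIs E A (λ m n → E (suc m) n) A-upper E-times-A , Ī-times-E)
  where
  open Matrices P
  open MatrixIdentities P enum
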